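{- Let $m\geq 2$ and $n\geq 2$ be integers, let $P_m$ be the path of order $m$ and let $K_n$ be the complete graph of order $n$. Then $rvcl(P_m \diamond K_n)=\max\{rvc(P_m),\, n+2\}$.
   Context: All graphs are finite, simple, connected and undirected; $d(\cdot,\cdot)$ is the graph distance. For $k\in\mathbb{N}$, a rainbow vertex $k$-coloring of $G$ is a function $c: V(G)\to\{1,\dots,k\}$ such that every two vertices $u,v$ are joined by a $u$–$v$ path whose internal vertices have pairwise distinct colors; $rvc(G)$ is the smallest positive integer $k$ for which such a coloring exists. For a rainbow vertex $k$-coloring $c$ (using all $k$ colors), let $R_i$ be the set of vertices of color $i$ and $\Pi=(R_1,\dots,R_k)$; the rainbow code of $v$ is $rc_\Pi(v)=(d(v,R_1),\dots,d(v,R_k))$, where $d(v,R_i)=\min_{x\in R_i} d(v,x)$. The coloring is a locating rainbow $k$-coloring if all vertices have pairwise distinct rainbow codes; $rvcl(G)$ is the smallest positive integer $k$ such that $G$ has a locating rainbow $k$-coloring. The edge corona $G\diamond H$ is obtained from one copy of $G$ and $|E(G)|$ copies of $H$, where, enumerating the edges of $G$ as $e_1,\dots,e_{|E(G)|}$, both end vertices of $e_j$ are joined to every vertex of the $j$-th copy of $H$. -}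

module Defs where

open import Data.Nat using (ℕ; zero; suc; _≤_; _<_; pred)
open import Data.Fin using (Fin; toℕ; inject₁) renaming (suc to fsuc)
open import Data.List using (List; []; _∷_; _++_; map)
open import Data.List.Relation.Unary.Unique.Propositional using (Unique)
open import Data.Product using (Σ; ∃; _×_; _,_; proj₁; proj₂)
open import Data.Sum using (_⊎_; inj₁; inj₂)
open import Relation.Binary.PropositionalEquality using (_≡_; _≢_)
open import Relation.Nullary using (¬_)
open import Function.Definitions using (Surjective)

record Graph : Set₁ where
  field
    V   : Set
    Adj : V → V → Set
open Graph public

module _ (G : Graph) where

  -- u–v walk whose list of internal vertices (in order) is the index.
  data IWalk : V G → V G → List (V G) → Set where
    edge : ∀ {u v} → Adj G u v → IWalk u v []
    via  : ∀ {u w v is} → Adj G u w → IWalk w v is → IWalk u v (w ∷ is)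

  data Walk : V G → V G → ℕ → Set where
    here : ∀ {u} → Walk u u 0
    step : ∀ {u w v k} → Adj G u w → Walk w v k → Walk u v (suc k)

  DistToSet : V G → (V G → Set) → ℕ → Set
  DistToSet v S k =
    (∃ λ x → S x × Walk v x k) × (∀ x j → S x → Walk v x j → k ≤ j)

  -- a rainbow vertex k-coloring (colors Fin k ≅ {1,…,k})
  RainbowColoring : (k : ℕ) → (V G → Fin k) → Set
  RainbowColoring k c = ∀ u v → u ≢ v →
    ∃ λ is → IWalk u v is × Unique (u ∷ is ++ (v ∷ [])) × Unique (map c is)

  HasRainbowColoring : ℕ → Set
  HasRainbowColoring k = Σ (V G → Fin k) (RainbowColoring k)

  ColorClass : ∀ {k} → (V G → Fin k) → Fin k → V G → Set
  ColorClass c i x = c x ≡ i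

  LocatingRainbowColoring : (k : ℕ) → (V G → Fin k) → Set
  LocatingRainbowColoring k c =
    RainbowColoring k c × Surjective _≡_ _≡_ c ×
    (∀ u v → u ≢ v → ∃ λ i → ∃ λ a → ∃ λ b →
        DistToSet u (ColorClass c i) a × DistToSet v (ColorClass c i) b × a ≢ b)

  HasLocatingRainbowColoring : ℕ → Set
  HasLocatingRainbowColoring k = Σ (V G → Fin k) (LocatingRainbowColoring k)

  IsRvc : ℕ → Set
  IsRvc k = 1 ≤ k × HasRainbowColoring k ×
            (∀ j → 1 ≤ j → j < k → ¬ HasRainbowColoring j)

  IsRvcl : ℕ → Set
  IsRvcl k = 1 ≤ k × HasLocatingRainbowColoring k ×
             (∀ j → 1 ≤ j → j < k → ¬ HasLocatingRainbowColoring j)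

PathGraph : ℕ → Graph
PathGraph m = record
  { V = Fin m
  ; Adj = λ i j → (suc (toℕ i) ≡ toℕ j) ⊎ (suc (toℕ j) ≡ toℕ i) }

pathEdges : (m : ℕ) → Fin (pred m) → Fin m × Fin m
pathEdges zero ()
pathEdges (suc m) j = inject₁ j , fsuc j

CompleteGraph : ℕ → Graph
CompleteGraph n = record { V = Fin n ; Adj = λ i j → i ≢ j }

-- edge corona G ⋄ H, given an enumeration of the E edges of G by their end vertices
EdgeCorona : (G : Graph) (E : ℕ) → (Fin E → V G × V G) → Graph → Graph
EdgeCorona G E ends H = record { V = VC ; Adj = A }
  where
  VC : Set
  VC = V G ⊎ (Fin E × V H)
  A : VC → VC → Set
  A (inj₁ a) (inj₁ b) = Adj G a b
  A (inj₂ (e , x)) (inj₂ (e' , y)) = (e ≡ e') × Adj H x y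
  A (inj₁ a) (inj₂ (e , x)) = (a ≡ proj₁ (ends e)) ⊎ (a ≡ proj₂ (ends e))
  A (inj₂ (e , x)) (inj₁ a) = (a ≡ proj₁ (ends e)) ⊎ (a ≡ proj₂ (ends e))

PathCoronaComplete : ℕ → ℕ → Graph
PathCoronaComplete m n = EdgeCorona (PathGraph m) (pred m) (pathEdges m) (CompleteGraph n)

-- Write m = M + 2, so that Pₘ is p₀ … p_{M+1} and the copy Q_e of Kₙ is joined to the edge p_e p_{e+1}.
--
-- Every p₀–p_{M+1} walk passes through the M inner path vertices, so a rainbow colouring
-- of Pₘ or of Pₘ ⋄ Kₙ gives them M distinct colours. The n + 1 vertices of {p₀} ∪ Q₀ all have the closed
-- neighbourhood {p₀, p₁} ∪ Q₀, so a locating colouring gives them distinct colours; with only n + 1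
-- colours p₁ would repeat the colour of one of them and share its rainbow code, since that vertex sees
-- every colour in its closed neighbourhood.
--
-- Colour modulo K = max(M, n + 2) so that the inner path vertices get distinct colours;
-- walks climbing along the path are then rainbow. The colours seen by each closed neighbourhood form a
-- cyclic interval, and vertices of equal colour see different intervals, so some colour is at distance 1
-- from one of them and at distance at least 2 from the other. One colouring serves M ≤ n + 1, another
-- M ≥ n + 2, and P₂ ⋄ Kₙ, the complete graph K_{n+2}, is coloured injectively.

{-# OPTIONS --safe #-}
module Submission where

open import Defs
open import Data.Empty using (⊥; ⊥-elim)
open import Data.Fin using (Fin; toℕ; fromℕ; fromℕ<; inject₁; punchOut; join; splitAt)
  renaming (zero to fzero; suc to fsuc)
import Data.Fin.Properties as Fin
open import Data.List using (List; []; _∷_; _++_; map; length; reverse; _∷ʳ_)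
open import Data.List.Membership.Propositional using (_∈_)
open import Data.List.Membership.Propositional.Properties using (∈-map⁺)
open import Data.List.Properties using (unfold-reverse; reverse-++; reverse-map)
import Data.List.Relation.Binary.Permutation.Setoid as Permutation
import Data.List.Relation.Binary.Permutation.Setoid.Properties as PermutationProperties
open import Data.List.Relation.Unary.All as All using (All; []; _∷_)
open import Data.List.Relation.Unary.AllPairs as AllPairs using (AllPairs; []; _∷_)
import Data.List.Relation.Unary.AllPairs.Properties as AllPairs
open import Data.List.Relation.Unary.Any using (Any; here; there)
import Data.List.Relation.Unary.Any as Any
open import Data.List.Relation.Unary.Unique.Propositional using (Unique)
open import Data.Nat
  using (ℕ; zero; suc; _≤_; _<_; _+_; _*_; _∸_; _⊓_; _⊔_; _%_; _≟_; _<?_; _≤?_; z≤n; s≤s; s≤s⁻¹; s<s⁻¹)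
open import Data.Nat.Divisibility using (n∣m*n)
open import Data.Nat.DivMod
  using (_mod_; %-distribˡ-+; %-remove-+ʳ; m%n%n≡m%n; m%n<n; m<n⇒m%n≡m; [m+n]%n≡m%n)
open import Data.Nat.Induction using (<-wellFounded)
open import Data.Nat.Properties
  using (≤-refl; ≤-reflexive; ≤-trans; ≤-antisym; ≤-total; <-trans; <-≤-trans; ≤-<-trans; <-irrefl; <-asym;
         <-cmp; ≤∧≢⇒<; <⇒≤; <⇒≱; ≰⇒>; ≮⇒≥; n≤1+n; n<1+n; n≢0⇒n>0; suc-injective; 0≢1+n;
         +-comm; +-assoc; +-suc; +-identityʳ; *-suc; *-monoʳ-≤; *-monoʳ-<; *-cancelˡ-≤; *-cancelˡ-<;
         *-cancelˡ-≡; even≢odd; m≤n+m∸n; m+[n∸m]≡n; m≤n⇒m∸n≡0; m∸n≤m; ∸-monoˡ-≤; ∸-monoʳ-<;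
         m≤n⇒m⊓n≡m; m≥n⇒m⊓n≡n; ⊔-lub; m≤m⊔n; m≤n⇒m⊔n≡n; m≥n⇒m⊔n≡m; m<1+n⇒m<n∨m≡n)
open import Data.Nat.Tactic.RingSolver using (solve-∀)
open import Data.Product using (Σ; ∃; _×_; _,_; proj₁; proj₂)
open import Data.Sum using (_⊎_; inj₁; inj₂; [_,_]; map₂)
open import Data.Sum.Properties using (inj₁-injective)
open import Function using (_∘_; id)
open import Function.Definitions using (Injective)
open import Induction.WellFounded using (Acc; acc)
open import Relation.Binary.Definitions using (Symmetric; tri<; tri≈; tri>)
open import Relation.Binary.PropositionalEquality
  using (_≡_; _≢_; refl; sym; trans; cong; cong₂; subst; subst₂; setoid; module ≡-Reasoning)
open import Relation.Nullary using (¬_; Dec; yes; no; ¬?; contradiction)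
open import Relation.Nullary.Decidable using (_×-dec_; _⊎-dec_)

open ≡-Reasoning

least-satisfying : {P : ℕ → Set} → (∀ j → Dec (P j)) → ∀ {L} → P L →
                   ∃ λ k → P k × (∀ {j} → j < k → ¬ P j)
least-satisfying P? {zero} pL = 0 , pL , λ ()
least-satisfying P? {suc L} pL with P? 0
... | yes p₀ = 0 , p₀ , λ ()
... | no ¬p₀ with least-satisfying (P? ∘ suc) pL
...   | k , pk , below = suc k , pk , λ { {zero} _ → ¬p₀ ; {suc j} j<k → below (s≤s⁻¹ j<k) }

unique-reverse : ∀ {A : Set} {xs : List A} → Unique xs → Unique (reverse xs)
unique-reverse {A} {xs} = Unique-resp-↭ (↭-sym (↭-reverse xs))
  where
  open Permutation (setoid A) using (↭-sym)
  open PermutationProperties (setoid A) using (Unique-resp-↭; ↭-reverse)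

unique-map-injectiveOn : ∀ {A B : Set} (f : A → B) {xs x y} →
  Unique (map f xs) → x ∈ xs → y ∈ xs → f x ≡ f y → x ≡ y
unique-map-injectiveOn f _ (here refl) (here refl) _ = refl
unique-map-injectiveOn f (fx∉ ∷ _) (here refl) (there y∈) eq = ⊥-elim (All.lookup fx∉ (∈-map⁺ f y∈) eq)
unique-map-injectiveOn f (fx∉ ∷ _) (there x∈) (here refl) eq = ⊥-elim (All.lookup fx∉ (∈-map⁺ f x∈) (sym eq))
unique-map-injectiveOn f (_ ∷ uq) (there x∈) (there y∈) eq = unique-map-injectiveOn f uq x∈ y∈ eq

injective⇒surjective : ∀ {m k} {f : Fin m → Fin k} → Injective _≡_ _≡_ f → k ≤ m →
                       ∀ i → ∃ λ t → f t ≡ i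
injective⇒surjective {m} {suc k} {f} f-inj k≤m i with Fin.any? (λ t → f t Fin.≟ i)
... | yes hit = hit
... | no miss = contradiction (≤-trans k≤m (Fin.injective⇒≤ g-inj)) (<-irrefl refl)
  where
  g : Fin m → Fin k
  g t = punchOut {i = i} (λ eq → miss (t , sym eq))
  g-inj : Injective _≡_ _≡_ g
  g-inj eq = f-inj (Fin.punchOut-injective {i = i} _ _ eq)

-- Walks, distances and rainbow codes

RainbowWalk : (G : Graph) {k : ℕ} → (V G → Fin k) → V G → V G → Set
RainbowWalk G c u v = ∃ λ is → IWalk G u v is × Unique (u ∷ is ++ v ∷ []) × Unique (map c is)

CodesDiffer : (G : Graph) {k : ℕ} → (V G → Fin k) → V G → V G → Set
CodesDiffer G c u v = ∃ λ i → ∃ λ a → ∃ λ b →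
  DistToSet G u (ColorClass G c i) a × DistToSet G v (ColorClass G c i) b × a ≢ b

NearColour : (G : Graph) {k : ℕ} → (V G → Fin k) → V G → Fin k → Set
NearColour G c v i = c v ≡ i ⊎ ∃ λ w → Adj G v w × c w ≡ i

Separates : (G : Graph) {k : ℕ} → (V G → Fin k) → Fin k → V G → V G → Set
Separates G c i u v = NearColour G c u i × ¬ NearColour G c v i

record DecidableGraph (G : Graph) : Set₁ where
  field
    any-vertex? : {P : V G → Set} → (∀ v → Dec (P v)) → Dec (∃ P)
    adjacent?   : ∀ u v → Dec (Adj G u v)

module _ {G : Graph} where

  IWalk⇒Walk : ∀ {u v is} → IWalk G u v is → Walk G u v (suc (length is))
  IWalk⇒Walk (edge a) = step a here
  IWalk⇒Walk (via a w) = step a (IWalk⇒Walk w)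

  IWalk-snoc : ∀ {u w v is} → IWalk G u w is → Adj G w v → IWalk G u v (is ∷ʳ w)
  IWalk-snoc (edge a) b = via a (edge b)
  IWalk-snoc (via a w) b = via a (IWalk-snoc w b)

  IWalk-reverse : Symmetric (Adj G) → ∀ {u v is} → IWalk G u v is → IWalk G v u (reverse is)
  IWalk-reverse adj-sym (edge a) = edge (adj-sym a)
  IWalk-reverse adj-sym (via {w = w} {is = is} a wk) rewrite unfold-reverse w is =
    IWalk-snoc (IWalk-reverse adj-sym wk) (adj-sym a)

  RainbowWalk-reverse : Symmetric (Adj G) → ∀ {k} {c : V G → Fin k} {u v} →
                        RainbowWalk G c u v → RainbowWalk G c v u
  RainbowWalk-reverse adj-sym {c = c} {u} {v} (is , w , uq , uq-c) =
    reverse is , IWalk-reverse adj-sym w ,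
    subst Unique ends-reversed (unique-reverse uq) ,
    subst Unique (sym (reverse-map c is)) (unique-reverse uq-c)
    where
    ends-reversed : reverse (u ∷ is ++ v ∷ []) ≡ v ∷ reverse is ++ u ∷ []
    ends-reversed = trans (unfold-reverse u (is ++ v ∷ [])) (cong (_∷ʳ u) (reverse-++ is (v ∷ [])))

  module _ (D : DecidableGraph G) {S : V G → Set} (S? : ∀ x → Dec (S x)) where
    open DecidableGraph D

    Reaches : ℕ → V G → Set
    Reaches j v = ∃ λ x → S x × Walk G v x j

    reaches? : ∀ j v → Dec (Reaches j v)
    reaches? zero v with S? v
    ... | yes s = yes (v , s , here)
    ... | no ¬s = no λ { (_ , s , here) → ¬s s }
    reaches? (suc j) v with any-vertex? (λ w → adjacent? v w ×-dec reaches? j w)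
    ... | yes (w , a , x , s , wk) = yes (x , s , step a wk)
    ... | no ¬r = no λ { (x , s , step a wk) → ¬r (_ , a , x , s , wk) }

    distance : ∀ {v x L} → S x → Walk G v x L → ∃ (DistToSet G v S)
    distance s wk with least-satisfying (λ j → reaches? j _) (_ , s , wk)
    ... | k , r , below = k , r , λ x j s wk → ≮⇒≥ (λ j<k → below j<k (x , s , wk))

  twin-dist≤ : ∀ {S : V G → Set} {u v a b} → (S u → S v) → (∀ w → Adj G u w → w ≡ v ⊎ Adj G v w) →
               DistToSet G u S a → DistToSet G v S b → b ≤ a
  twin-dist≤ Su⇒Sv _ ((_ , s , here) , _) (_ , v-min) = v-min _ 0 (Su⇒Sv s) here
  twin-dist≤ _ N[u]⊆N[v] ((x , s , step {w = w} a wk) , _) (_ , v-min) with N[u]⊆N[v] w a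
  ... | inj₁ refl = ≤-trans (v-min x _ s wk) (n≤1+n _)
  ... | inj₂ a′ = v-min x _ s (step a′ wk)

  walk-crosses : (level : V G → ℕ) {t : ℕ} →
                 (∀ {a b} → Adj G a b → level a < t → t < level b → ⊥) →
                 ∀ {u v is} → IWalk G u v is → level u < t → t < level v → Any (λ w → level w ≡ t) is
  walk-crosses level no-jump (edge a) lu lv = ⊥-elim (no-jump a lu lv)
  walk-crosses level {t} no-jump (via {w = w} a wk) lu lv with <-cmp (level w) t
  ... | tri< lw _ _ = there (walk-crosses level no-jump wk lw lv)
  ... | tri≈ _ eq _ = here eq
  ... | tri> _ _ lw = ⊥-elim (no-jump a lu lw)

  module _ {k : ℕ} (c : V G → Fin k) where

    rainbow-level-bound : RainbowColoring G k c → (level : V G → ℕ) → ∀ {u v m} (w : Fin m → V G) →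
      u ≢ v → Injective _≡_ _≡_ w → (∀ t → level u < level (w t)) → (∀ t → level (w t) < level v) →
      (∀ t {a b} → Adj G a b → level a < level (w t) → level (w t) < level b → ⊥) →
      (∀ t x → level x ≡ level (w t) → x ≡ w t) → m ≤ k
    rainbow-level-bound rb level w u≢v w-inj above-u below-v no-jump only-w with rb _ _ u≢v
    ... | is , wk , _ , uq-c = Fin.injective⇒≤ {f = c ∘ w}
          (λ {s} {t} eq → w-inj (unique-map-injectiveOn c uq-c (on-walk s) (on-walk t) eq))
      where
      on-walk : ∀ t → w t ∈ is
      on-walk t = Any.map (λ eq → sym (only-w t _ eq))
                          (walk-crosses level (no-jump t) wk (above-u t) (below-v t))

    dist-own : ∀ u → DistToSet G u (ColorClass G c (c u)) 0
    dist-own u = (u , refl , here) , λ _ _ _ _ → z≤n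

    dist≢0 : ∀ {v i b} → c v ≢ i → DistToSet G v (ColorClass G c i) b → b ≢ 0
    dist≢0 cv≢i ((_ , s , here) , _) refl = cv≢i s

    dist≤1 : ∀ {u i a} → NearColour G c u i → DistToSet G u (ColorClass G c i) a → a ≤ 1
    dist≤1 (inj₁ cu≡i) (_ , u-min) = ≤-trans (u-min _ 0 cu≡i here) z≤n
    dist≤1 (inj₂ (w , a , cw≡i)) (_ , u-min) = u-min w 1 cw≡i (step a here)

    dist≥2 : ∀ {v i b} → ¬ NearColour G c v i → DistToSet G v (ColorClass G c i) b → 2 ≤ b
    dist≥2 far ((_ , s , here) , _) = ⊥-elim (far (inj₁ s))
    dist≥2 far ((x , s , step a here) , _) = ⊥-elim (far (inj₂ (x , a , s)))
    dist≥2 far ((_ , _ , step _ (step _ _)) , _) = s≤s (s≤s z≤n)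

    separates⇒codesDiffer : ∀ {i u v} → Separates G c i u v →
      ∃ (DistToSet G u (ColorClass G c i)) → ∃ (DistToSet G v (ColorClass G c i)) → CodesDiffer G c u v
    separates⇒codesDiffer {i} (near , far) (a , da) (b , db) =
      i , a , b , da , db , λ { refl → <⇒≱ (s≤s (dist≤1 near da)) (dist≥2 far db) }

    CodesDiffer-sym : ∀ {u v} → CodesDiffer G c u v → CodesDiffer G c v u
    CodesDiffer-sym (i , a , b , da , db , a≢b) = i , b , a , db , da , λ eq → a≢b (sym eq)

    locating-intro : DecidableGraph G → RainbowColoring G k c → (∀ i → ∃ λ x → c x ≡ i) →
      (∀ u v → u ≢ v → c u ≡ c v → (∃ λ i → Separates G c i u v) ⊎ (∃ λ i → Separates G c i v u)) →
      LocatingRainbowColoring G k c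
    locating-intro D rb onto separated = rb , surjective , codes
      where
      dist-to : ∀ v i → ∃ (DistToSet G v (ColorClass G c i))
      dist-to v i with c v Fin.≟ i | onto i
      ... | yes cv≡i | _ = distance D (λ x → c x Fin.≟ i) cv≡i here
      ... | no cv≢i | x , cx≡i with rb v x (λ { refl → cv≢i cx≡i })
      ...   | _ , wk , _ = distance D (λ y → c y Fin.≟ i) cx≡i (IWalk⇒Walk wk)

      surjective : ∀ i → ∃ λ x → ∀ {z} → z ≡ x → c z ≡ i
      surjective i with onto i
      ... | x , cx≡i = x , λ { refl → cx≡i }

      codes : ∀ u v → u ≢ v → CodesDiffer G c u v
      codes u v u≢v with c u Fin.≟ c v
      ... | no cu≢cv with dist-to v (c u)
      ...   | b , db = c u , 0 , b , dist-own u , db , λ 0≡b → dist≢0 (λ eq → cu≢cv (sym eq)) db (sym 0≡b)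
      codes u v u≢v | yes cu≡cv with separated u v u≢v cu≡cv
      ... | inj₁ (i , sep) = separates⇒codesDiffer sep (dist-to u i) (dist-to v i)
      ... | inj₂ (i , sep) = CodesDiffer-sym (separates⇒codesDiffer sep (dist-to v i) (dist-to u i))

    twins⇒colours-differ : ∀ {u v} → CodesDiffer G c u v →
      (∀ w → Adj G u w → w ≡ v ⊎ Adj G v w) → (∀ w → Adj G v w → w ≡ u ⊎ Adj G u w) → c u ≢ c v
    twins⇒colours-differ (i , a , b , da , db , a≢b) N[u]⊆N[v] N[v]⊆N[u] cu≡cv = a≢b (≤-antisym
      (twin-dist≤ (λ cv≡i → trans cu≡cv cv≡i) N[v]⊆N[u] db da)
      (twin-dist≤ (λ cu≡i → trans (sym cu≡cv) cu≡i) N[u]⊆N[v] da db))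

    sees-all⇒same-code : ∀ {u v} → c u ≡ c v → (∀ w → Adj G u w → w ≡ v ⊎ Adj G v w) →
      (∀ i → NearColour G c u i) → ¬ CodesDiffer G c u v
    sees-all⇒same-code {u} cu≡cv N[u]⊆N[v] near (i , a , b , da , db , a≢b) = a≢b (≤-antisym a≤b b≤a)
      where
      b≤a : b ≤ a
      b≤a = twin-dist≤ (λ cu≡i → trans (sym cu≡cv) cu≡i) N[u]⊆N[v] da db
      a≤b : a ≤ b
      a≤b with c u Fin.≟ i
      ... | yes cu≡i = ≤-trans (proj₂ da u 0 cu≡i here) z≤n
      ... | no cu≢i = ≤-trans (dist≤1 (near i) da) (n≢0⇒n>0 (dist≢0 (λ cv≡i → cu≢i (trans cu≡cv cv≡i)) db))

    clique-twins-bound : LocatingRainbowColoring G k c → ∀ {m} (T : Fin m → V G) (p : V G) →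
      Injective _≡_ _≡_ T → (∀ {s t} → s ≢ t → Adj G (T s) (T t)) →
      (∀ {s t} → s ≢ t → ∀ w → Adj G (T s) w → w ≡ T t ⊎ Adj G (T t) w) →
      (∀ t w → Adj G (T t) w → w ≡ p ⊎ Adj G p w) → (∀ t → T t ≢ p) → suc m ≤ k
    clique-twins-bound (_ , _ , codes) {m} T p T-inj clique twins dominated T≢p = ≰⇒> k≰m
      where
      colour-inj : Injective _≡_ _≡_ (c ∘ T)
      colour-inj {s} {t} eq with s Fin.≟ t
      ... | yes s≡t = s≡t
      ... | no s≢t = ⊥-elim (twins⇒colours-differ (codes _ _ (s≢t ∘ T-inj)) (twins s≢t) (twins (s≢t ∘ sym)) eq)

      k≰m : ¬ k ≤ m
      k≰m k≤m with injective⇒surjective colour-inj k≤m (c p)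
      ... | t , cTt≡cp = sees-all⇒same-code cTt≡cp (dominated t) near (codes (T t) p (T≢p t))
        where
        near : ∀ i → NearColour G c (T t) i
        near i with injective⇒surjective colour-inj k≤m i
        ... | s , cTs≡i with s Fin.≟ t
        ...   | yes refl = inj₁ cTs≡i
        ...   | no s≢t = inj₂ (T s , clique (s≢t ∘ sym) , cTs≡i)

module Ascending (G : Graph) (adj-sym : ∀ {u v} → Adj G u v → Adj G v u)
                 (level : V G → ℕ) (Inner : V G → Set) where

  data AscWalk : V G → V G → List (V G) → Set where
    edge : ∀ {u v} → Adj G u v → level u < level v → AscWalk u v []
    via  : ∀ {u w v is} → Adj G u w → level u < level w → Inner w → AscWalk w v is → AscWalk u v (w ∷ is)

  Step : Set
  Step = ∀ u v → level u < level v →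
    Adj G u v ⊎ ∃ λ w → Adj G u w × Inner w × level u < level w × level w < level v

  ascWalk : Step → ∀ {u v} → level u < level v → ∃ (AscWalk u v)
  ascWalk next {u} {v} lt = go u (<-wellFounded (level v ∸ level u)) lt
    where
    go : ∀ u → Acc _<_ (level v ∸ level u) → level u < level v → ∃ (AscWalk u v)
    go u (acc rec) lt with next u v lt
    ... | inj₁ a = [] , edge a lt
    ... | inj₂ (w , a , inner , u<w , w<v) with go w (rec (∸-monoʳ-< u<w (<⇒≤ w<v))) w<v
    ...   | is , rest = w ∷ is , via a u<w inner rest

  above : ∀ {u v is} → AscWalk u v is → All (λ y → level u < level y) (is ++ v ∷ [])
  above (edge _ lt) = lt ∷ []
  above (via _ lt _ rest) = lt ∷ All.map (<-trans lt) (above rest)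

  inner-above : ∀ {u v is} → AscWalk u v is → All (λ y → Inner y × level u < level y) is
  inner-above (edge _ _) = []
  inner-above (via _ lt inner rest) =
    (inner , lt) ∷ All.map (λ (i , lt′) → i , <-trans lt lt′) (inner-above rest)

  AscWalk⇒IWalk : ∀ {u v is} → AscWalk u v is → IWalk G u v is
  AscWalk⇒IWalk (edge a _) = edge a
  AscWalk⇒IWalk (via a _ _ rest) = via a (AscWalk⇒IWalk rest)

  AscWalk-unique : ∀ {u v is} → AscWalk u v is → Unique (u ∷ is ++ v ∷ [])
  AscWalk-unique wk = AllPairs.map (λ lt eq → <-irrefl (cong level eq) lt) (sorted wk)
    where
    sorted : ∀ {u v is} → AscWalk u v is → AllPairs (λ x y → level x < level y) (u ∷ is ++ v ∷ [])
    sorted wk@(edge _ _) = above wk ∷ [] ∷ []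
    sorted wk@(via _ _ _ rest) = above wk ∷ sorted rest

  module _ {k} (c : V G → Fin k)
           (separated : ∀ {x y} → Inner x → Inner y → c x ≡ c y → level x ≡ level y) where

    AscWalk-colours : ∀ {u v is} → AscWalk u v is → Unique (map c is)
    AscWalk-colours wk = AllPairs.map⁺ (distinct wk)
      where
      distinct : ∀ {u v is} → AscWalk u v is → AllPairs (λ x y → c x ≢ c y) is
      distinct (edge _ _) = []
      distinct (via _ _ inner rest) =
        All.map (λ (inner′ , lt) eq → <-irrefl (separated inner inner′ eq) lt) (inner-above rest) ∷
        distinct rest

    AscWalk-rainbow : ∀ {u v is} → AscWalk u v is → RainbowWalk G c u v
    AscWalk-rainbow wk = _ , AscWalk⇒IWalk wk , AscWalk-unique wk , AscWalk-colours wk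

    rainbow-ascending : Step → (∀ u v → u ≢ v → level u ≡ level v → Adj G u v) → RainbowColoring G k c
    rainbow-ascending next same-level u v u≢v with <-cmp (level u) (level v)
    ... | tri< lt _ _ = AscWalk-rainbow (proj₂ (ascWalk next lt))
    ... | tri≈ _ eq _ = [] , edge (same-level u v u≢v eq) , (u≢v ∷ []) ∷ [] ∷ [] , []
    ... | tri> _ _ gt = RainbowWalk-reverse adj-sym (AscWalk-rainbow (proj₂ (ascWalk next gt)))

-- Arcs of colours modulo K

module Arcs (K′ : ℕ) where

  K : ℕ
  K = suc K′

  col : ℕ → Fin K
  col x = x mod K

  toℕ-col : ∀ x → toℕ (col x) ≡ x % K
  toℕ-col x = Fin.toℕ-fromℕ< (m%n<n x K)

  col-injective : ∀ x y → col x ≡ col y → x % K ≡ y % K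
  col-injective x y eq = trans (sym (toℕ-col x)) (trans (cong toℕ eq) (toℕ-col y))

  +-%-congʳ : ∀ z z′ s → z % K ≡ z′ % K → (z + s) % K ≡ (z′ + s) % K
  +-%-congʳ z z′ s eq = begin
    (z + s) % K           ≡⟨ %-distribˡ-+ z s K ⟩
    (z % K + s % K) % K   ≡⟨ cong (λ r → (r + s % K) % K) eq ⟩
    (z′ % K + s % K) % K  ≡⟨ %-distribˡ-+ z′ s K ⟨
    (z′ + s) % K          ∎

  -- a * K′ plays the role of -a modulo K.
  private
    swap-negation : ∀ a x k → x + (a + a * k) ≡ (a + x) + a * k
    swap-negation = solve-∀

    add-negation : ∀ a b k → b + a * k + a ≡ b + (a + a * k)
    add-negation = solve-∀

  %-cancelˡ-+ : ∀ a {x y} → (a + x) % K ≡ (a + y) % K → x % K ≡ y % K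
  %-cancelˡ-+ a {x} {y} eq = begin
    x % K                   ≡⟨ %-remove-+ʳ x (n∣m*n a) ⟨
    (x + a * K) % K         ≡⟨ cong (λ r → (x + r) % K) (*-suc a K′) ⟩
    (x + (a + a * K′)) % K  ≡⟨ cong (_% K) (swap-negation a x K′) ⟩
    (a + x + a * K′) % K    ≡⟨ +-%-congʳ (a + x) (a + y) (a * K′) eq ⟩
    (a + y + a * K′) % K    ≡⟨ cong (_% K) (swap-negation a y K′) ⟨
    (y + (a + a * K′)) % K  ≡⟨ cong (λ r → (y + r) % K) (*-suc a K′) ⟨
    (y + a * K) % K         ≡⟨ %-remove-+ʳ y (n∣m*n a) ⟩
    y % K                   ∎

  offset : ∀ a b → ∃ λ D → D < K × (D + a) % K ≡ b % K
  offset a b = (b + a * K′) % K , m%n<n (b + a * K′) K , (begin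
    ((b + a * K′) % K + a) % K  ≡⟨ +-%-congʳ ((b + a * K′) % K) (b + a * K′) a (m%n%n≡m%n (b + a * K′) K) ⟩
    (b + a * K′ + a) % K        ≡⟨ cong (_% K) (add-negation a b K′) ⟩
    (b + (a + a * K′)) % K      ≡⟨ cong (λ r → (b + r) % K) (*-suc a K′) ⟨
    (b + a * K) % K             ≡⟨ %-remove-+ʳ b (n∣m*n a) ⟩
    b % K                       ∎)

  data InArc (a ℓ : ℕ) (i : Fin K) : Set where
    within : ∀ δ → δ < ℓ → i ≡ col (a + δ) → InArc a ℓ i

  %-injective : ∀ {x y} → x < K → y < K → x % K ≡ y % K → x ≡ y
  %-injective x<K y<K eq = trans (sym (m<n⇒m%n≡m x<K)) (trans eq (m<n⇒m%n≡m y<K))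

  col-injective-< : ∀ {x y} → x < K → y < K → col x ≡ col y → x ≡ y
  col-injective-< {x} {y} x<K y<K eq = %-injective x<K y<K (col-injective x y eq)

  col-toℕ : ∀ i → col (toℕ i) ≡ i
  col-toℕ i = Fin.toℕ-injective (trans (toℕ-col (toℕ i)) (m<n⇒m%n≡m (Fin.toℕ<n i)))

  col-cancelˡ : ∀ s {x y} → x < K → y < K → col (s + x) ≡ col (s + y) → x ≡ y
  col-cancelˡ s {x} {y} x<K y<K eq = %-injective x<K y<K (%-cancelˡ-+ s (col-injective (s + x) (s + y) eq))

  col-injective-≤ : ∀ {x y} → 1 ≤ x → x ≤ K → 1 ≤ y → y ≤ K → col x ≡ col y → x ≡ y
  col-injective-≤ {x} {y} 1≤x x≤K 1≤y y≤K eq = begin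
    x            ≡⟨ m+[n∸m]≡n 1≤x ⟨
    1 + (x ∸ 1)  ≡⟨ cong suc (col-cancelˡ 1 (s≤s (∸-monoˡ-≤ 1 x≤K)) (s≤s (∸-monoˡ-≤ 1 y≤K)) shifted) ⟩
    1 + (y ∸ 1)  ≡⟨ m+[n∸m]≡n 1≤y ⟩
    y            ∎
    where
    shifted : col (1 + (x ∸ 1)) ≡ col (1 + (y ∸ 1))
    shifted = trans (cong col (m+[n∸m]≡n 1≤x)) (trans eq (cong col (sym (m+[n∸m]≡n 1≤y))))

  col-+0 : ∀ x → col x ≡ col (x + 0)
  col-+0 x = cong col (sym (+-identityʳ x))

  col-+K : ∀ x → col (K + x) ≡ col x
  col-+K x = Fin.toℕ-injective (begin
    toℕ (col (K + x))  ≡⟨ toℕ-col (K + x) ⟩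
    (K + x) % K        ≡⟨ cong (_% K) (+-comm K x) ⟩
    (x + K) % K        ≡⟨ [m+n]%n≡m%n x K ⟩
    x % K              ≡⟨ toℕ-col x ⟨
    toℕ (col x)        ∎)

  InArc-intro : ∀ {a ℓ x} δ → δ < ℓ → x ≡ a + δ → InArc a ℓ (col x)
  InArc-intro δ δ<ℓ eq = within δ δ<ℓ (cong col eq)

  InArc-≡ : ∀ {a ℓ i j} → i ≡ j → InArc a ℓ j → InArc a ℓ i
  InArc-≡ refl arc = arc

  InArc-start : ∀ {a ℓ} → 1 ≤ ℓ → InArc a ℓ (col a)
  InArc-start {a} 1≤ℓ = InArc-intro 0 1≤ℓ (sym (+-identityʳ a))

  InArc-wrap : ∀ {a ℓ x} δ → δ < ℓ → K + x ≡ a + δ → InArc a ℓ (col x)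
  InArc-wrap {x = x} δ δ<ℓ eq = within δ δ<ℓ (trans (sym (col-+K x)) (cong col eq))

  InArc-full : ∀ a i → InArc a K i
  InArc-full a i with offset a (toℕ i)
  ... | D , D<K , D+a≡i = within D D<K (Fin.toℕ-injective (begin
    toℕ i              ≡⟨ m<n⇒m%n≡m (Fin.toℕ<n i) ⟨
    toℕ i % K          ≡⟨ D+a≡i ⟨
    (D + a) % K        ≡⟨ cong (_% K) (+-comm D a) ⟩
    (a + D) % K        ≡⟨ toℕ-col (a + D) ⟨
    toℕ (col (a + D))  ∎))

  private
    escape-length : ∀ D ℓ₁ ℓ₂ → ℓ₁ ≤ ℓ₂ → 1 ≤ ℓ₂ → (D ≡ 0 → ℓ₁ < ℓ₂) → ℓ₁ ∸ D < ℓ₂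
    escape-length zero ℓ₁ ℓ₂ _ _ D≡0⇒ = D≡0⇒ refl
    escape-length (suc D) zero ℓ₂ _ 1≤ℓ₂ _ = 1≤ℓ₂
    escape-length (suc D) (suc ℓ) ℓ₂ ℓ₁≤ℓ₂ _ _ = <-≤-trans (s≤s (m∸n≤m ℓ D)) ℓ₁≤ℓ₂

    offset-bound : ∀ D ℓ₁ → D < K → ℓ₁ < K → D + (ℓ₁ ∸ D) < K
    offset-bound D ℓ₁ D<K ℓ₁<K with ≤-total D ℓ₁
    ... | inj₁ D≤ℓ₁ = subst (_< K) (sym (m+[n∸m]≡n D≤ℓ₁)) ℓ₁<K
    ... | inj₂ ℓ₁≤D = subst (_< K) (sym (trans (cong (D +_) (m≤n⇒m∸n≡0 ℓ₁≤D)) (+-identityʳ D))) D<K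

  -- With D the offset of a₂ from a₁, the colour a₂ + (ℓ₁ ∸ D) lies at offset D ⊔ ℓ₁ ≥ ℓ₁ from a₁.
  arc-escapes : ∀ a₁ a₂ {ℓ₁ ℓ₂} → ℓ₁ ≤ ℓ₂ → ℓ₁ < K → 1 ≤ ℓ₂ → (a₁ % K ≢ a₂ % K ⊎ ℓ₁ < ℓ₂) →
                ∃ λ δ → δ < ℓ₂ × ¬ InArc a₁ ℓ₁ (col (a₂ + δ))
  arc-escapes a₁ a₂ {ℓ₁} {ℓ₂} ℓ₁≤ℓ₂ ℓ₁<K 1≤ℓ₂ differ with offset a₁ a₂
  ... | D , D<K , D+a₁≡a₂ = ℓ₁ ∸ D , escape-length D ℓ₁ ℓ₂ ℓ₁≤ℓ₂ 1≤ℓ₂ same-start , outside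
    where
    same-start : D ≡ 0 → ℓ₁ < ℓ₂
    same-start refl = [ (λ a₁≢a₂ → ⊥-elim (a₁≢a₂ D+a₁≡a₂)) , id ] differ

    outside : ¬ InArc a₁ ℓ₁ (col (a₂ + (ℓ₁ ∸ D)))
    outside (within δ′ δ′<ℓ₁ eq) = <-irrefl δ′≡ (<-≤-trans δ′<ℓ₁ (m≤n+m∸n ℓ₁ D))
      where
      δ = ℓ₁ ∸ D
      cancelled : (D + δ) % K ≡ δ′ % K
      cancelled = %-cancelˡ-+ a₁ (begin
        (a₁ + (D + δ)) % K  ≡⟨ cong (_% K) (trans (sym (+-assoc a₁ D δ)) (cong (_+ δ) (+-comm a₁ D))) ⟩
        (D + a₁ + δ) % K    ≡⟨ +-%-congʳ (D + a₁) a₂ δ D+a₁≡a₂ ⟩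
        (a₂ + δ) % K        ≡⟨ col-injective (a₂ + δ) (a₁ + δ′) eq ⟩
        (a₁ + δ′) % K       ∎)
      δ′≡ : δ′ ≡ D + δ
      δ′≡ = trans (sym (m<n⇒m%n≡m (<-trans δ′<ℓ₁ ℓ₁<K)))
              (trans (sym cancelled) (m<n⇒m%n≡m (offset-bound D ℓ₁ D<K ℓ₁<K)))

  -- Class v ℓ: the colours seen by the closed neighbourhood of v form an arc of length ℓ,
  -- starting at `start` of the class.
  module ArcColouring {G : Graph} (c : V G → Fin K)
    (Class : V G → ℕ → Set) (class : ∀ v → ∃ (Class v)) (start : ∀ {v ℓ} → Class v ℓ → ℕ)
    (length-bounds : ∀ {v ℓ} → Class v ℓ → 1 ≤ ℓ × ℓ ≤ K)
    (covers : ∀ {v ℓ} (w : Class v ℓ) δ → δ < ℓ → NearColour G c v (col (start w + δ)))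
    (own : ∀ {v ℓ} (w : Class v ℓ) → InArc (start w) ℓ (c v))
    (nbrs : ∀ {v ℓ} (w : Class v ℓ) u → Adj G v u → InArc (start w) ℓ (c u))
    (same-arc : ∀ {u v ℓ} (wu : Class u ℓ) (wv : Class v ℓ) → c u ≡ c v →
                ℓ ≡ K ⊎ start wu % K ≡ start wv % K → u ≡ v)
    where

    private
      len : V G → ℕ
      len v = proj₁ (class v)

      arc : ∀ v → Class v (len v)
      arc v = proj₂ (class v)

      len≤K : ∀ v → len v ≤ K
      len≤K v = proj₂ (length-bounds (arc v))

      confined : ∀ {v ℓ} (w : Class v ℓ) i → NearColour G c v i → InArc (start w) ℓ i
      confined w _ (inj₁ refl) = own w
      confined w _ (inj₂ (u , a , refl)) = nbrs w u a

      escape : ∀ u v → len u ≤ len v → len u < K →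
               (start (arc u) % K ≢ start (arc v) % K ⊎ len u < len v) → ∃ λ i → Separates G c i v u
      escape u v ℓu≤ℓv ℓu<K differ
        with arc-escapes (start (arc u)) (start (arc v)) ℓu≤ℓv ℓu<K (proj₁ (length-bounds (arc v))) differ
      ... | δ , δ< , outside =
        col (start (arc v) + δ) , covers (arc v) δ δ< , λ near → outside (confined (arc u) _ near)

      determined : ∀ u v → c u ≡ c v → len u ≡ len v →
                   len u ≡ K ⊎ start (arc u) % K ≡ start (arc v) % K → u ≡ v
      determined u v = same-length (arc u) (arc v)
        where
        same-length : ∀ {ℓ ℓ′} (wu : Class u ℓ) (wv : Class v ℓ′) → c u ≡ c v → ℓ ≡ ℓ′ →
                      ℓ ≡ K ⊎ start wu % K ≡ start wv % K → u ≡ v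
        same-length wu wv colours refl = same-arc wu wv colours

    separated : ∀ u v → u ≢ v → c u ≡ c v → (∃ λ i → Separates G c i u v) ⊎ (∃ λ i → Separates G c i v u)
    separated u v u≢v cu≡cv with <-cmp (len u) (len v)
    ... | tri< lt _ _ = inj₂ (escape u v (<⇒≤ lt) (<-≤-trans lt (len≤K v)) (inj₂ lt))
    ... | tri> _ _ gt = inj₁ (escape v u (<⇒≤ gt) (<-≤-trans gt (len≤K u)) (inj₂ gt))
    ... | tri≈ _ same-len _ with len u ≟ K | start (arc u) % K ≟ start (arc v) % K
    ...   | yes full | _ = ⊥-elim (u≢v (determined u v cu≡cv same-len (inj₁ full)))
    ...   | no _ | yes same-start = ⊥-elim (u≢v (determined u v cu≡cv same-len (inj₂ same-start)))
    ...   | no partial | no differ =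
      inj₂ (escape u v (≤-reflexive same-len) (≤∧≢⇒< (len≤K u) partial) (inj₁ differ))

-- The path Pₘ and the corona Pₘ ⋄ Kₙ

Interior : (M : ℕ) → Fin (2 + M) → Set
Interior M a = 1 ≤ toℕ a × toℕ a ≤ M

successor : ∀ {N} (a : Fin (suc N)) → toℕ a < N → Fin (suc N)
successor a a<N = fsuc (fromℕ< a<N)

toℕ-successor : ∀ {N} (a : Fin (suc N)) (a<N : toℕ a < N) → toℕ (successor a a<N) ≡ suc (toℕ a)
toℕ-successor a a<N = cong suc (Fin.toℕ-fromℕ< a<N)

successor-interior : ∀ {M} (a : Fin (2 + M)) (sa≤M : suc (toℕ a) ≤ M) →
                     Interior M (successor a (≤-trans sa≤M (n≤1+n M)))
successor-interior {M} a sa≤M =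
  subst (λ t → 1 ≤ t × t ≤ M) (sym (toℕ-successor a (≤-trans sa≤M (n≤1+n M)))) (s≤s z≤n , sa≤M)

module Path (M : ℕ) where

  P : Graph
  P = PathGraph (2 + M)

  adj-sym : Symmetric (Adj P)
  adj-sym {a} {b} (inj₁ e) = inj₂ e
  adj-sym {a} {b} (inj₂ e) = inj₁ e

  no-jump : ∀ {a b t} → Adj P a b → toℕ a < t → t < toℕ b → ⊥
  no-jump {t = t} (inj₁ e) a<t t<b = <⇒≱ a<t (s≤s⁻¹ (subst (t <_) (sym e) t<b))
  no-jump {b = b} (inj₂ e) a<t t<b = <-asym (<-trans a<t t<b) (subst (toℕ b <_) e (n<1+n _))

  module _ {k} (c : Fin (2 + M) → Fin k) where

    rainbow : (∀ {a b} → Interior M a → Interior M b → c a ≡ c b → a ≡ b) → RainbowColoring P k c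
    rainbow inj = rainbow-ascending c (λ ia ib → cong toℕ ∘ inj ia ib) next same-level
      where
      open Ascending P adj-sym toℕ (Interior M)
      next : Step
      next a b a<b with suc (toℕ a) ≟ toℕ b
      ... | yes adj = inj₁ (inj₁ adj)
      ... | no ¬adj = inj₂ (successor a (≤-trans sa≤M (n≤1+n M)) , inj₁ (sym ≡sa) , successor-interior a sa≤M ,
                           subst (toℕ a <_) (sym ≡sa) (n<1+n _) , subst (_< toℕ b) (sym ≡sa) sa<b)
        where
        sa<b : suc (toℕ a) < toℕ b
        sa<b = ≤∧≢⇒< a<b ¬adj
        sa≤M : suc (toℕ a) ≤ M
        sa≤M = s≤s⁻¹ (<-≤-trans sa<b (Fin.toℕ≤pred[n] b))
        ≡sa : toℕ (successor a (≤-trans sa≤M (n≤1+n M))) ≡ suc (toℕ a)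
        ≡sa = toℕ-successor a (≤-trans sa≤M (n≤1+n M))
      same-level : ∀ a b → a ≢ b → toℕ a ≡ toℕ b → Adj P a b
      same-level _ _ a≢b eq = ⊥-elim (a≢b (Fin.toℕ-injective eq))

    rainbow-bound : RainbowColoring P k c → M ≤ k
    rainbow-bound rb = rainbow-level-bound c rb toℕ cut (λ ()) cut-injective
      (λ _ → s≤s z≤n) below (λ _ → no-jump) (λ t x eq → Fin.toℕ-injective eq)
      where
      cut : Fin M → Fin (2 + M)
      cut t = fsuc (inject₁ t)
      cut-injective : ∀ {s t} → cut s ≡ cut t → s ≡ t
      cut-injective eq = Fin.inject₁-injective (Fin.suc-injective eq)
      below : ∀ t → toℕ (cut t) < toℕ (fromℕ (suc M))
      below t = subst₂ _<_ (cong suc (sym (Fin.toℕ-inject₁ t))) (sym (Fin.toℕ-fromℕ (suc M)))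
                           (s≤s (Fin.toℕ<n t))

even<even⁻ : ∀ a b → 2 * a < 2 * b → a < b
even<even⁻ a b = *-cancelˡ-< 2 a b

even<odd⁻ : ∀ a e → 2 * a < suc (2 * e) → a ≤ e
even<odd⁻ a e lt = *-cancelˡ-≤ 2 (s≤s⁻¹ lt)

odd<even⁻ : ∀ e b → suc (2 * e) < 2 * b → e < b
odd<even⁻ e b lt = even<even⁻ e b (<-trans (n<1+n (2 * e)) lt)

odd<odd⁻ : ∀ e e′ → suc (2 * e) < suc (2 * e′) → e < e′
odd<odd⁻ e e′ lt = even<even⁻ e e′ (s<s⁻¹ lt)

odd<even-suc : ∀ e → suc (2 * e) < 2 * suc e
odd<even-suc e = subst (suc (2 * e) <_) (sym (*-suc 2 e)) ≤-refl

even-mono-< : ∀ a b → a < b → 2 * a < 2 * b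
even-mono-< a b = *-monoʳ-< 2 {a} {b}

even-mono-≤ : ∀ a b → a ≤ b → 2 * a ≤ 2 * b
even-mono-≤ a b = *-monoʳ-≤ 2 {a} {b}

even-injective : ∀ a b → 2 * a ≡ 2 * b → a ≡ b
even-injective a b = *-cancelˡ-≡ a b 2

module Corona (M n : ℕ) where

  G : Graph
  G = PathCoronaComplete (2 + M) n

  pattern p a = inj₁ a
  pattern q e x = inj₂ (e , x)

  adj-sym : Symmetric (Adj G)
  adj-sym {p a} {p b} (inj₁ e) = inj₂ e
  adj-sym {p a} {p b} (inj₂ e) = inj₁ e
  adj-sym {p _} {q _ _} a = a
  adj-sym {q _ _} {p _} a = a
  adj-sym {q _ _} {q _ _} (e≡e′ , x≢y) = sym e≡e′ , x≢y ∘ sym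

  decidable : DecidableGraph G
  decidable = record { any-vertex? = any-vertex? ; adjacent? = adjacent? }
    where
    any-vertex? : {P : V G → Set} → (∀ v → Dec (P v)) → Dec (∃ P)
    any-vertex? P? with Fin.any? (P? ∘ p) | Fin.any? (λ e → Fin.any? (λ x → P? (q e x)))
    ... | yes (a , pa) | _ = yes (p a , pa)
    ... | no _ | yes (e , x , pex) = yes (q e x , pex)
    ... | no ¬path | no ¬copy = no λ { (p a , pa) → ¬path (a , pa) ; (q e x , pex) → ¬copy (e , x , pex) }

    adjacent? : ∀ u v → Dec (Adj G u v)
    adjacent? (p a) (p b) = (suc (toℕ a) ≟ toℕ b) ⊎-dec (suc (toℕ b) ≟ toℕ a)
    adjacent? (p a) (q e _) = (a Fin.≟ inject₁ e) ⊎-dec (a Fin.≟ fsuc e)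
    adjacent? (q e _) (p a) = (a Fin.≟ inject₁ e) ⊎-dec (a Fin.≟ fsuc e)
    adjacent? (q e x) (q e′ y) = (e Fin.≟ e′) ×-dec ¬? (x Fin.≟ y)

  open DecidableGraph decidable using (adjacent?)

  p-next-copy : ∀ a (a<M : toℕ a < M) y → Adj G (p (fsuc a)) (q (successor a a<M) y)
  p-next-copy a a<M y =
    inj₁ (cong fsuc (Fin.toℕ-injective (sym (trans (Fin.toℕ-inject₁ (fromℕ< a<M)) (Fin.toℕ-fromℕ< a<M)))))

  level : V G → ℕ
  level (p a) = 2 * toℕ a
  level (q e _) = suc (2 * toℕ e)

  Inner : V G → Set
  Inner (p a) = Interior M a
  Inner (q _ _) = ⊥

  Advance : V G → V G → Set
  Advance u v = ∃ λ w → Adj G u w × Inner w × level u < level w × level w < level v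

  advance-path : ∀ a {v} → suc (toℕ a) ≤ M → 2 * suc (toℕ a) < level v → Advance (p a) v
  advance-path a {v} sa≤M lt =
    p (successor a (≤-trans sa≤M (n≤1+n M))) , inj₁ (sym ≡sa) , successor-interior a sa≤M ,
    subst (λ t → 2 * toℕ a < 2 * t) (sym ≡sa) (even-mono-< (toℕ a) (suc (toℕ a)) (n<1+n (toℕ a))) ,
    subst (λ t → 2 * t < level v) (sym ≡sa) lt
    where
    ≡sa : toℕ (successor a (≤-trans sa≤M (n≤1+n M))) ≡ suc (toℕ a)
    ≡sa = toℕ-successor a (≤-trans sa≤M (n≤1+n M))

  advance-copy : ∀ e {x v} → suc (toℕ e) ≤ M → 2 * suc (toℕ e) < level v → Advance (q e x) v
  advance-copy e se≤M lt = p (fsuc e) , inj₂ refl , (s≤s z≤n , se≤M) , odd<even-suc (toℕ e) , lt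

  advance : ∀ {u v} → level u < level v → ¬ Adj G u v → Advance u v
  advance {p a} {p b} lt ¬adj =
    advance-path a {p b} (s≤s⁻¹ (<-≤-trans sa<b (Fin.toℕ≤pred[n] b))) (even-mono-< (suc (toℕ a)) (toℕ b) sa<b)
    where
    sa<b : suc (toℕ a) < toℕ b
    sa<b = ≤∧≢⇒< (even<even⁻ (toℕ a) (toℕ b) lt) (¬adj ∘ inj₁)
  advance {p a} {q e x} lt ¬adj =
    advance-path a {q e x} (≤-trans a<e (Fin.toℕ≤pred[n] e)) (s≤s (even-mono-≤ (suc (toℕ a)) (toℕ e) a<e))
    where
    a<e : toℕ a < toℕ e
    a<e = ≤∧≢⇒< (even<odd⁻ (toℕ a) (toℕ e) lt)
                 λ eq → ¬adj (inj₁ (Fin.toℕ-injective (trans eq (sym (Fin.toℕ-inject₁ e)))))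
  advance {q e x} {p b} lt ¬adj =
    advance-copy e {x} {p b} (s≤s⁻¹ (<-≤-trans se<b (Fin.toℕ≤pred[n] b)))
                             (even-mono-< (suc (toℕ e)) (toℕ b) se<b)
    where
    se<b : suc (toℕ e) < toℕ b
    se<b = ≤∧≢⇒< (odd<even⁻ (toℕ e) (toℕ b) lt) λ eq → ¬adj (inj₂ (Fin.toℕ-injective (sym eq)))
  advance {q e x} {q e′ y} lt _ =
    advance-copy e {x} {q e′ y} (≤-trans e<e′ (Fin.toℕ≤pred[n] e′))
                                (s≤s (even-mono-≤ (suc (toℕ e)) (toℕ e′) e<e′))
    where
    e<e′ : toℕ e < toℕ e′
    e<e′ = odd<odd⁻ (toℕ e) (toℕ e′) lt

  same-level : ∀ u v → u ≢ v → level u ≡ level v → Adj G u v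
  same-level (p a) (p b) u≢v eq = ⊥-elim (u≢v (cong p (Fin.toℕ-injective (even-injective (toℕ a) (toℕ b) eq))))
  same-level (p a) (q e _) _ eq = ⊥-elim (even≢odd (toℕ a) (toℕ e) eq)
  same-level (q e _) (p a) _ eq = ⊥-elim (even≢odd (toℕ a) (toℕ e) (sym eq))
  same-level (q e x) (q e′ y) u≢v eq with Fin.toℕ-injective (even-injective (toℕ e) (toℕ e′) (suc-injective eq))
  ... | refl = refl , λ x≡y → u≢v (cong (λ z → q e z) x≡y)

  at-even-level : ∀ {x} b → level x ≡ 2 * toℕ b → x ≡ p b
  at-even-level {p a} b eq = cong p (Fin.toℕ-injective (even-injective (toℕ a) (toℕ b) eq))
  at-even-level {q e _} b eq = ⊥-elim (even≢odd (toℕ b) (toℕ e) (sym eq))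

  -- An edge joins levels differing by at most 2, and by exactly 2 only between even ones.
  no-jump-even : ∀ {a b} L → Adj G a b → level a < 2 * L → 2 * L < level b → ⊥
  no-jump-even {p a} {p b} L (inj₁ e) lt gt =
    <⇒≱ (even<even⁻ (toℕ a) L lt) (s≤s⁻¹ (subst (L <_) (sym e) (even<even⁻ L (toℕ b) gt)))
  no-jump-even {p a} {p b} L (inj₂ e) lt gt =
    <-asym (<-trans (even<even⁻ (toℕ a) L lt) (even<even⁻ L (toℕ b) gt)) (subst (toℕ b <_) e (n<1+n (toℕ b)))
  no-jump-even {p _} {q e _} L (inj₁ refl) lt gt =
    <⇒≱ (subst (_< L) (Fin.toℕ-inject₁ e) (even<even⁻ _ L lt)) (even<odd⁻ L (toℕ e) gt)
  no-jump-even {p _} {q e _} L (inj₂ refl) lt gt =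
    <⇒≱ (<-trans (n<1+n (toℕ e)) (even<even⁻ (suc (toℕ e)) L lt)) (even<odd⁻ L (toℕ e) gt)
  no-jump-even {q e _} {p _} L (inj₁ refl) lt gt =
    <-asym (odd<even⁻ (toℕ e) L lt) (subst (L <_) (Fin.toℕ-inject₁ e) (even<even⁻ L _ gt))
  no-jump-even {q e _} {p _} L (inj₂ refl) lt gt =
    <⇒≱ (odd<even⁻ (toℕ e) L lt) (s≤s⁻¹ (even<even⁻ L (suc (toℕ e)) gt))
  no-jump-even {q _ _} {q _ _} L (refl , _) lt gt = <-asym lt gt

  -- p₀ and the copy of Kₙ on the first edge form a clique of n + 1 twins, all adjacent to p₁.
  T : Fin (suc n) → V G
  T fzero = p fzero
  T (fsuc x) = q fzero x

  hub : V G
  hub = p (fsuc fzero)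

  T-injective : Injective _≡_ _≡_ T
  T-injective {fzero} {fzero} _ = refl
  T-injective {fzero} {fsuc _} ()
  T-injective {fsuc _} {fzero} ()
  T-injective {fsuc _} {fsuc _} refl = refl

  T≢hub : ∀ t → T t ≢ hub
  T≢hub fzero ()
  T≢hub (fsuc _) ()

  clique : ∀ {s t} → s ≢ t → Adj G (T s) (T t)
  clique {fzero} {fzero} s≢t = ⊥-elim (s≢t refl)
  clique {fzero} {fsuc _} _ = inj₁ refl
  clique {fsuc _} {fzero} _ = inj₁ refl
  clique {fsuc _} {fsuc _} s≢t = refl , λ x≡y → s≢t (cong fsuc x≡y)

  hub-adj : ∀ t → Adj G hub (T t)
  hub-adj fzero = inj₂ refl
  hub-adj (fsuc _) = inj₂ refl

  T-nbrs : ∀ s w → Adj G (T s) w → w ≡ hub ⊎ ∃ λ t → w ≡ T t × t ≢ s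
  T-nbrs fzero (p b) (inj₁ e) = inj₁ (cong p (Fin.toℕ-injective {i = b} {j = fsuc fzero} (sym e)))
  T-nbrs fzero (q fzero y) (inj₁ refl) = inj₂ (fsuc y , refl , λ ())
  T-nbrs (fsuc _) (p _) (inj₁ refl) = inj₂ (fzero , refl , λ ())
  T-nbrs (fsuc _) (p _) (inj₂ refl) = inj₁ refl
  T-nbrs (fsuc x) (q _ y) (refl , x≢y) = inj₂ (fsuc y , refl , λ eq → x≢y (sym (Fin.suc-injective eq)))

  twins : ∀ {s t} → s ≢ t → ∀ w → Adj G (T s) w → w ≡ T t ⊎ Adj G (T t) w
  twins {s} {t} s≢t w a with T-nbrs s w a
  ... | inj₁ refl = inj₂ (adj-sym {hub} {T t} (hub-adj t))
  ... | inj₂ (t′ , refl , _) with t′ Fin.≟ t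
  ...   | yes refl = inj₁ refl
  ...   | no t′≢t = inj₂ (clique (t′≢t ∘ sym))

  dominated : ∀ t w → Adj G (T t) w → w ≡ hub ⊎ Adj G hub w
  dominated t w a with T-nbrs t w a
  ... | inj₁ w≡hub = inj₁ w≡hub
  ... | inj₂ (t′ , refl , _) = inj₂ (hub-adj t′)

  module _ {k} (c : V G → Fin k) where

    copy-near : ∀ e x y → NearColour G c (q e x) (c (q e y))
    copy-near e x y with x Fin.≟ y
    ... | yes refl = inj₁ refl
    ... | no x≢y = inj₂ (q e y , (refl , x≢y) , refl)

    rainbow : (∀ {a b} → Interior M a → Interior M b → c (p a) ≡ c (p b) → a ≡ b) → RainbowColoring G k c
    rainbow inj = rainbow-ascending c separated next same-level
      where
      open Ascending G (λ {u} {v} → adj-sym {u} {v}) level Inner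
      separated : ∀ {x y} → Inner x → Inner y → c x ≡ c y → level x ≡ level y
      separated {p _} {p _} ia ib eq = cong (λ z → 2 * toℕ z) (inj ia ib eq)
      next : Step
      next u v lt with adjacent? u v
      ... | yes adj = inj₁ adj
      ... | no ¬adj = inj₂ (advance {u} {v} lt ¬adj)

    rainbow-bound : RainbowColoring G k c → M ≤ k
    rainbow-bound rb =
      rainbow-level-bound c rb level {p fzero} {p (fromℕ (suc M))} (λ t → p (cut t)) (λ ()) cut-injective
        (λ _ → s≤s z≤n) below (λ t {a} {b} → no-jump-even {a} {b} (toℕ (cut t)))
        (λ t x → at-even-level {x} (cut t))
      where
      cut : Fin M → Fin (2 + M)
      cut t = fsuc (inject₁ t)
      cut-injective : ∀ {s t} → p (cut s) ≡ p (cut t) → s ≡ t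
      cut-injective eq = Fin.inject₁-injective (Fin.suc-injective (inj₁-injective eq))
      below : ∀ t → level (p (cut t)) < level (p (fromℕ (suc M)))
      below t = even-mono-< _ _ (subst₂ _<_ (cong suc (sym (Fin.toℕ-inject₁ t))) (sym (Fin.toℕ-fromℕ (suc M)))
                                      (s≤s (Fin.toℕ<n t)))

    twin-bound : LocatingRainbowColoring G k c → suc (suc n) ≤ k
    twin-bound loc = clique-twins-bound c loc T hub T-injective clique twins dominated T≢hub

-- Locating rainbow colourings of Pₘ ⋄ Kₙ

module ShortPath (M n : ℕ) (1≤M : 1 ≤ M) (M≤n+1 : M ≤ suc n) (1≤n : 1 ≤ n) where
  open Corona M n hiding (rainbow)
  open Arcs (suc n)

  hue : V G → ℕ
  hue (p a) = toℕ a ⊓ M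
  hue (q e x) = suc (toℕ e + toℕ x)

  c : V G → Fin K
  c v = col (hue v)

  M<K : M < K
  M<K = s≤s M≤n+1

  c-path : ∀ {a} t → toℕ a ≡ t → t ≤ M → c (p a) ≡ col t
  c-path t refl t≤M = cong col (m≤n⇒m⊓n≡m t≤M)

  c-end : ∀ a → toℕ a ≡ M → c (p (fsuc a)) ≡ col (toℕ a)
  c-end a a≡M = cong col (trans (m≥n⇒m⊓n≡n (≤-trans (≤-reflexive (sym a≡M)) (n≤1+n _))) (sym a≡M))

  c-copy : ∀ e {y} (y<n : y < n) → c (q e (fromℕ< y<n)) ≡ col (toℕ e + suc y)
  c-copy e y<n = cong col (trans (cong (λ j → suc (toℕ e + j)) (Fin.toℕ-fromℕ< y<n)) (sym (+-suc (toℕ e) _)))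

  data Class : V G → ℕ → Set where
    first : Class (p fzero) (suc n)
    inner : ∀ a → toℕ a < M → Class (p (fsuc a)) K
    last  : ∀ a → toℕ a ≡ M → Class (p (fsuc a)) (suc n)
    copy  : ∀ e x → Class (q e x) (suc n)

  class : ∀ v → ∃ (Class v)
  class (p fzero) = _ , first
  class (p (fsuc a)) with toℕ a ≟ M
  ... | yes a≡M = _ , last a a≡M
  ... | no a≢M = _ , inner a (≤∧≢⇒< (Fin.toℕ≤pred[n] a) a≢M)
  class (q e x) = _ , copy e x

  start : ∀ {v ℓ} → Class v ℓ → ℕ
  start first = 0
  start (inner a _) = toℕ a
  start (last a _) = toℕ a
  start (copy e _) = toℕ e

  covers : ∀ {v ℓ} (w : Class v ℓ) δ → δ < ℓ → NearColour G c v (col (start w + δ))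
  covers first zero _ = inj₁ refl
  covers first (suc y) (s≤s y<n) = inj₂ (q fzero (fromℕ< y<n) , inj₁ refl , c-copy fzero y<n)
  covers (inner a a<M) zero _ =
    inj₂ (p (inject₁ a) , inj₂ (cong suc (Fin.toℕ-inject₁ a)) ,
          trans (c-path (toℕ a) (Fin.toℕ-inject₁ a) (<⇒≤ a<M)) (col-+0 (toℕ a)))
  covers (inner a a<M) (suc zero) _ = inj₁ (trans (c-path (suc (toℕ a)) refl a<M) (cong col (+-comm 1 (toℕ a))))
  covers (inner a a<M) (suc (suc y)) (s≤s (s≤s y<n)) =
    inj₂ (q (successor a a<M) (fromℕ< y<n) , p-next-copy a a<M (fromℕ< y<n) ,
          trans (c-copy (successor a a<M) y<n)
                (cong col (trans (cong (_+ suc y) (toℕ-successor a a<M)) (sym (+-suc (toℕ a) (suc y))))))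
  covers (last a a≡M) zero _ = inj₁ (trans (c-end a a≡M) (col-+0 (toℕ a)))
  covers (last a a≡M) (suc y) (s≤s y<n) = inj₂ (q a (fromℕ< y<n) , inj₂ refl , c-copy a y<n)
  covers (copy e x) zero _ =
    inj₂ (p (inject₁ e) , inj₁ refl ,
          trans (c-path (toℕ e) (Fin.toℕ-inject₁ e) (Fin.toℕ≤pred[n] e)) (col-+0 (toℕ e)))
  covers (copy e x) (suc y) (s≤s y<n) =
    subst (NearColour G c (q e x)) (c-copy e y<n) (copy-near c e x (fromℕ< y<n))

  own : ∀ {v ℓ} (w : Class v ℓ) → InArc (start w) ℓ (c v)
  own first = InArc-intro 0 (s≤s z≤n) refl
  own (inner a _) = InArc-full _ _
  own (last a a≡M) = InArc-≡ (c-end a a≡M) (InArc-start (s≤s z≤n))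
  own (copy e x) = InArc-intro (suc (toℕ x)) (s≤s (Fin.toℕ<n x)) (sym (+-suc (toℕ e) (toℕ x)))

  nbrs : ∀ {v ℓ} (w : Class v ℓ) u → Adj G v u → InArc (start w) ℓ (c u)
  nbrs first (p b) (inj₁ 1≡b) = within 1 (s≤s 1≤n) (c-path 1 (sym 1≡b) 1≤M)
  nbrs first (q fzero y) (inj₁ refl) = InArc-intro (suc (toℕ y)) (s≤s (Fin.toℕ<n y)) refl
  nbrs (inner _ _) _ _ = InArc-full _ _
  nbrs (last a a≡M) (p b) (inj₁ 2+a≡b) =
    ⊥-elim (<-irrefl refl (≤-trans (≤-reflexive 2+a≡b)
                                    (subst (toℕ b ≤_) (cong suc (sym a≡M)) (Fin.toℕ≤pred[n] b))))
  nbrs (last a a≡M) (p b) (inj₂ 1+b≡1+a) =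
    InArc-≡ (c-path (toℕ a) (suc-injective 1+b≡1+a) (≤-reflexive a≡M)) (InArc-start (s≤s z≤n))
  nbrs (last a a≡M) (q e y) (inj₁ 1+a≡e) =
    ⊥-elim (<-irrefl refl (≤-trans (≤-reflexive (trans (cong toℕ 1+a≡e) (Fin.toℕ-inject₁ e)))
                                    (subst (toℕ e ≤_) (sym a≡M) (Fin.toℕ≤pred[n] e))))
  nbrs (last a a≡M) (q _ y) (inj₂ refl) =
    InArc-intro (suc (toℕ y)) (s≤s (Fin.toℕ<n y)) (sym (+-suc (toℕ a) (toℕ y)))
  nbrs (copy e x) (p _) (inj₁ refl) =
    InArc-≡ (c-path (toℕ e) (Fin.toℕ-inject₁ e) (Fin.toℕ≤pred[n] e)) (InArc-start (s≤s z≤n))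
  nbrs (copy e x) (p _) (inj₂ refl) with toℕ e ≟ M
  ... | yes e≡M = InArc-≡ (c-end e e≡M) (InArc-start (s≤s z≤n))
  ... | no e≢M =
    InArc-≡ (c-path (suc (toℕ e)) refl (≤∧≢⇒< (Fin.toℕ≤pred[n] e) e≢M)) (InArc-intro 1 (s≤s 1≤n) (+-comm 1 (toℕ e)))
  nbrs (copy e x) (q _ y) (refl , _) =
    InArc-intro (suc (toℕ y)) (s≤s (Fin.toℕ<n y)) (sym (+-suc (toℕ e) (toℕ y)))

  index<K : ∀ (e : Fin (suc M)) → toℕ e < K
  index<K e = <-≤-trans (s≤s (Fin.toℕ≤pred[n] e)) M<K

  1+x<K : ∀ (x : Fin n) → suc (toℕ x) < K
  1+x<K x = s≤s (≤-trans (Fin.toℕ<n x) (n≤1+n n))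

  first-last : ∀ (a : Fin (suc M)) → toℕ a ≡ M → 0 % K ≢ toℕ a % K
  first-last a a≡M starts =
    <-irrefl (%-injective (s≤s z≤n) (index<K a) starts) (subst (1 ≤_) (sym a≡M) 1≤M)

  first-copy : ∀ e x → c (p fzero) ≡ c (q e x) → 0 % K ≢ toℕ e % K
  first-copy e x colours starts = 0≢1+n (col-injective-< (s≤s z≤n) (1+x<K x)
    (trans colours (cong (λ t → col (suc (t + toℕ x))) (sym (%-injective (s≤s z≤n) (index<K e) starts)))))

  last-copy : ∀ (a : Fin (suc M)) e x → toℕ a ≡ M → c (p (fsuc a)) ≡ c (q e x) → toℕ a % K ≢ toℕ e % K
  last-copy a e x a≡M colours starts = 0≢1+n (col-cancelˡ (toℕ a) (s≤s z≤n) (1+x<K x) (begin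
    col (toℕ a + 0)            ≡⟨ col-+0 (toℕ a) ⟨
    col (toℕ a)                ≡⟨ c-end a a≡M ⟨
    c (p (fsuc a))             ≡⟨ colours ⟩
    col (suc (toℕ e + toℕ x))  ≡⟨ cong col (sym (+-suc (toℕ e) (toℕ x))) ⟩
    col (toℕ e + suc (toℕ x))  ≡⟨ cong (λ t → col (t + suc (toℕ x))) a≡e ⟨
    col (toℕ a + suc (toℕ x))  ∎))
    where
    a≡e : toℕ a ≡ toℕ e
    a≡e = %-injective (index<K a) (index<K e) starts

  -- The missing case suc n ≡ suc (suc n) is refuted by unification.
  partial : ∀ {X : Set} → suc n ≡ K ⊎ X → X
  partial (inj₂ x) = x

  same-arc : ∀ {u v ℓ} (wu : Class u ℓ) (wv : Class v ℓ) → c u ≡ c v →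
             ℓ ≡ K ⊎ start wu % K ≡ start wv % K → u ≡ v
  same-arc first first _ _ = refl
  same-arc (inner a a<M) (inner b b<M) colours _ = cong (λ t → p (fsuc t)) (Fin.toℕ-injective (suc-injective
    (col-injective-< (s≤s (≤-trans a<M M≤n+1)) (s≤s (≤-trans b<M M≤n+1))
      (trans (sym (c-path (suc (toℕ a)) refl a<M)) (trans colours (c-path (suc (toℕ b)) refl b<M))))))
  same-arc (last a a≡M) (last b b≡M) _ _ = cong (λ t → p (fsuc t)) (Fin.toℕ-injective (trans a≡M (sym b≡M)))
  same-arc (copy e x) (copy e′ y) colours same
    with Fin.toℕ-injective {i = e} {j = e′} (%-injective (index<K e) (index<K e′) (partial same))
  ... | refl = cong (λ t → q e t) (Fin.toℕ-injective (suc-injective (col-cancelˡ (toℕ e) (1+x<K x) (1+x<K y)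
    (trans (cong col (+-suc (toℕ e) (toℕ x))) (trans colours (cong col (sym (+-suc (toℕ e) (toℕ y)))))))))
  same-arc first (last a a≡M) _ same = ⊥-elim (first-last a a≡M (partial same))
  same-arc (last a a≡M) first _ same = ⊥-elim (first-last a a≡M (sym (partial same)))
  same-arc first (copy e x) colours same = ⊥-elim (first-copy e x colours (partial same))
  same-arc (copy e x) first colours same = ⊥-elim (first-copy e x (sym colours) (sym (partial same)))
  same-arc (last a a≡M) (copy e x) colours same = ⊥-elim (last-copy a e x a≡M colours (partial same))
  same-arc (copy e x) (last a a≡M) colours same =
    ⊥-elim (last-copy a e x a≡M (sym colours) (sym (partial same)))

  hue-onto : ∀ t → t < K → ∃ λ v → hue v ≡ t
  hue-onto zero _ = p fzero , refl
  hue-onto (suc t) 1+t<K with t <? n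
  ... | yes t<n = q fzero (fromℕ< t<n) , cong suc (Fin.toℕ-fromℕ< t<n)
  ... | no t≮n = q (fromℕ< (s≤s 1≤M)) (fromℕ< n-1<n) , cong suc (begin
      toℕ (fromℕ< (s≤s 1≤M)) + toℕ (fromℕ< n-1<n)
        ≡⟨ cong₂ _+_ (Fin.toℕ-fromℕ< (s≤s 1≤M)) (Fin.toℕ-fromℕ< n-1<n) ⟩
      1 + (n ∸ 1)                                  ≡⟨ m+[n∸m]≡n 1≤n ⟩
      n                                            ≡⟨ ≤-antisym (≮⇒≥ t≮n) (s≤s⁻¹ (s≤s⁻¹ 1+t<K)) ⟩
      t                                            ∎)
    where
    n-1<n : n ∸ 1 < n
    n-1<n = ≤-reflexive (m+[n∸m]≡n 1≤n)

  onto : ∀ i → ∃ λ v → c v ≡ i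
  onto i with hue-onto (toℕ i) (Fin.toℕ<n i)
  ... | v , hue≡ = v , trans (cong col hue≡) (col-toℕ i)

  length-bounds : ∀ {v ℓ} → Class v ℓ → 1 ≤ ℓ × ℓ ≤ K
  length-bounds first = s≤s z≤n , n≤1+n _
  length-bounds (inner _ _) = s≤s z≤n , ≤-refl
  length-bounds (last _ _) = s≤s z≤n , n≤1+n _
  length-bounds (copy _ _) = s≤s z≤n , n≤1+n _

  rainbow : RainbowColoring G K c
  rainbow = Corona.rainbow M n c interior-injective
    where
    interior-injective : ∀ {a b} → Interior M a → Interior M b → c (p a) ≡ c (p b) → a ≡ b
    interior-injective {a} {b} (_ , a≤M) (_ , b≤M) colours = Fin.toℕ-injective (col-injective-<
      (≤-<-trans a≤M M<K) (≤-<-trans b≤M M<K)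
      (trans (sym (c-path (toℕ a) refl a≤M)) (trans colours (c-path (toℕ b) refl b≤M))))

  locating : LocatingRainbowColoring G K c
  locating = locating-intro c decidable rainbow onto
    (ArcColouring.separated c Class class start length-bounds covers own nbrs same-arc)

module LongPath (K′ n : ℕ) (2≤n : 2 ≤ n) (n+2≤M : suc (suc n) ≤ suc K′) where
  M : ℕ
  M = suc K′

  open Corona M n hiding (rainbow)
  open Arcs K′

  n<K′ : n < K′
  n<K′ = s≤s⁻¹ n+2≤M

  hue : V G → ℕ
  hue (p fzero) = K′
  hue (p (fsuc a)) with toℕ a ≟ M
  ... | yes _ = n
  ... | no _ = suc (toℕ a)
  hue (q e x) = toℕ e + toℕ x

  c : V G → Fin K
  c v = col (hue v)

  c-path : ∀ {b} t → toℕ b ≡ t → 1 ≤ t → t ≤ M → c (p b) ≡ col t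
  c-path {fsuc a} t refl _ t≤M with toℕ a ≟ M
  ... | yes a≡M = ⊥-elim (<-irrefl a≡M t≤M)
  ... | no _ = refl

  c-last : ∀ {a} → toℕ a ≡ M → c (p (fsuc a)) ≡ col n
  c-last {a} a≡M with toℕ a ≟ M
  ... | yes _ = refl
  ... | no a≢M = ⊥-elim (a≢M a≡M)

  c-copy : ∀ e {y} (y<n : y < n) → c (q e (fromℕ< y<n)) ≡ col (toℕ e + y)
  c-copy e y<n = cong (λ j → col (toℕ e + j)) (Fin.toℕ-fromℕ< y<n)

  wrap : ∀ y → col y ≡ col (K′ + suc y)
  wrap y = trans (sym (col-+K y)) (cong col (sym (+-suc K′ y)))

  col-M+ : ∀ {e : Fin (suc M)} y → toℕ e ≡ M → col (toℕ e + y) ≡ col (0 + y)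
  col-M+ y e≡M = trans (cong (λ t → col (t + y)) e≡M) (col-+K y)

  data Class : V G → ℕ → Set where
    p-first  : Class (p fzero) (suc n)
    p-second : Class (p (fsuc fzero)) (suc (suc n))
    p-mid    : ∀ a → 1 ≤ toℕ a → toℕ a < K′ → Class (p (fsuc a)) (suc n)
    p-pen    : ∀ a → toℕ a ≡ K′ → Class (p (fsuc a)) (suc (suc n))
    p-last   : ∀ a → toℕ a ≡ M → Class (p (fsuc a)) (suc n)
    q-first  : ∀ x → Class (q fzero x) (suc n)
    q-mid    : ∀ e x → 1 ≤ toℕ e → toℕ e < M → Class (q e x) n
    q-last   : ∀ e x → toℕ e ≡ M → Class (q e x) (suc n)

  class : ∀ v → ∃ (Class v)
  class (p fzero) = _ , p-first
  class (p (fsuc fzero)) = _ , p-second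
  class (p (fsuc a@(fsuc _))) with toℕ a ≟ M | toℕ a ≟ K′
  ... | yes a≡M | _ = _ , p-last a a≡M
  ... | no _ | yes a≡K′ = _ , p-pen a a≡K′
  ... | no a≢M | no a≢K′ = _ , p-mid a (s≤s z≤n) (≤∧≢⇒< (s≤s⁻¹ (≤∧≢⇒< (Fin.toℕ≤pred[n] a) a≢M)) a≢K′)
  class (q fzero x) = _ , q-first x
  class (q e@(fsuc _) x) with toℕ e ≟ M
  ... | yes e≡M = _ , q-last e x e≡M
  ... | no e≢M = _ , q-mid e x (s≤s z≤n) (≤∧≢⇒< (Fin.toℕ≤pred[n] e) e≢M)

  start : ∀ {v ℓ} → Class v ℓ → ℕ
  start p-first = K′
  start p-second = K′
  start (p-mid a _ _) = toℕ a
  start (p-pen _ _) = K′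
  start (p-last _ _) = 0
  start (q-first _) = K′
  start (q-mid e _ _ _) = toℕ e
  start (q-last _ _ _) = 0

  1≤K′ : 1 ≤ K′
  1≤K′ = ≤-trans (s≤s z≤n) n<K′

  1≤n : 1 ≤ n
  1≤n = ≤-trans (s≤s z≤n) 2≤n

  n-1<n : n ∸ 1 < n
  n-1<n = ≤-reflexive (m+[n∸m]≡n 1≤n)

  mid<M : ∀ {a : Fin (suc M)} → toℕ a < K′ → toℕ a < M
  mid<M a<K′ = <-trans a<K′ ≤-refl

  pen<M : ∀ {a : Fin (suc M)} → toℕ a ≡ K′ → toℕ a < M
  pen<M a≡K′ = ≤-reflexive (cong suc a≡K′)

  toℕ-after-pen : ∀ {a : Fin (suc M)} (a≡K′ : toℕ a ≡ K′) → toℕ (successor a (pen<M a≡K′)) ≡ M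
  toℕ-after-pen {a} a≡K′ = trans (toℕ-successor a (pen<M a≡K′)) (cong suc a≡K′)

  path-covers : ∀ {a ℓ} (w : Class (p a) ℓ) δ → δ < ℓ → NearColour G c (p a) (col (start w + δ))
  path-covers p-first zero _ = inj₁ (col-+0 K′)
  path-covers p-first (suc y) (s≤s y<n) =
    inj₂ (q fzero (fromℕ< y<n) , inj₁ refl , trans (c-copy fzero y<n) (wrap y))
  path-covers p-second zero _ = inj₂ (p fzero , inj₂ refl , col-+0 K′)
  path-covers p-second (suc y) (s≤s y≤n) with m<1+n⇒m<n∨m≡n y≤n
  ... | inj₁ y<n = inj₂ (q fzero (fromℕ< y<n) , inj₂ refl , trans (c-copy fzero y<n) (wrap y))
  ... | inj₂ refl = inj₂ (q (fsuc fzero) (fromℕ< n-1<n) , inj₁ refl ,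
                          trans (c-copy (fsuc fzero) n-1<n) (trans (cong col (m+[n∸m]≡n 1≤n)) (wrap n)))
  path-covers (p-mid a 1≤a a<K′) zero _ =
    inj₂ (p (inject₁ a) , inj₂ (cong suc (Fin.toℕ-inject₁ a)) ,
          trans (c-path (toℕ a) (Fin.toℕ-inject₁ a) 1≤a (<⇒≤ (mid<M a<K′))) (col-+0 (toℕ a)))
  path-covers (p-mid a 1≤a a<K′) (suc y) (s≤s y<n) =
    inj₂ (q (successor a (mid<M a<K′)) (fromℕ< y<n) , p-next-copy a (mid<M a<K′) (fromℕ< y<n) ,
          trans (c-copy (successor a (mid<M a<K′)) y<n)
                (cong col (trans (cong (_+ y) (toℕ-successor a (mid<M a<K′))) (sym (+-suc (toℕ a) y)))))
  path-covers (p-pen a a≡K′) zero _ =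
    inj₂ (p (inject₁ a) , inj₂ (cong suc (Fin.toℕ-inject₁ a)) ,
          trans (c-path K′ (trans (Fin.toℕ-inject₁ a) a≡K′) 1≤K′ (n≤1+n K′)) (col-+0 K′))
  path-covers (p-pen a a≡K′) (suc y) (s≤s y≤n) with m<1+n⇒m<n∨m≡n y≤n
  ... | inj₁ y<n = inj₂ (q (successor a (pen<M a≡K′)) (fromℕ< y<n) , p-next-copy a (pen<M a≡K′) (fromℕ< y<n) ,
                         trans (c-copy (successor a (pen<M a≡K′)) y<n)
                               (trans (col-M+ y (toℕ-after-pen a≡K′)) (wrap y)))
  ... | inj₂ refl = inj₂ (p (fsuc (successor a (pen<M a≡K′))) ,
                          inj₁ (cong suc (sym (toℕ-successor a (pen<M a≡K′)))) ,
                          trans (c-last (toℕ-after-pen a≡K′)) (wrap n))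
  path-covers (p-last a a≡M) δ δ≤n with m<1+n⇒m<n∨m≡n δ≤n
  ... | inj₁ δ<n = inj₂ (q a (fromℕ< δ<n) , inj₂ refl , trans (c-copy a δ<n) (col-M+ δ a≡M))
  ... | inj₂ refl = inj₁ (c-last a≡M)

  copy-covers : ∀ {e x ℓ} (w : Class (q e x) ℓ) δ → δ < ℓ → NearColour G c (q e x) (col (start w + δ))
  copy-covers (q-first x) zero _ = inj₂ (p fzero , inj₁ refl , col-+0 K′)
  copy-covers (q-first x) (suc y) (s≤s y<n) =
    subst (NearColour G c (q fzero x)) (trans (c-copy fzero y<n) (wrap y)) (copy-near c fzero x (fromℕ< y<n))
  copy-covers (q-mid e x _ _) δ δ<n =
    subst (NearColour G c (q e x)) (c-copy e δ<n) (copy-near c e x (fromℕ< δ<n))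
  copy-covers (q-last e x e≡M) δ δ≤n with m<1+n⇒m<n∨m≡n δ≤n
  ... | inj₁ δ<n =
    subst (NearColour G c (q e x)) (trans (c-copy e δ<n) (col-M+ δ e≡M)) (copy-near c e x (fromℕ< δ<n))
  ... | inj₂ refl = inj₂ (p (fsuc e) , inj₂ refl , c-last e≡M)

  covers : ∀ {v ℓ} (w : Class v ℓ) δ → δ < ℓ → NearColour G c v (col (start w + δ))
  covers {p _} = path-covers
  covers {q _ _} = copy-covers

  own : ∀ {v ℓ} (w : Class v ℓ) → InArc (start w) ℓ (c v)
  own p-first = InArc-start (s≤s z≤n)
  own p-second = InArc-wrap 2 (s≤s (s≤s 1≤n)) (sym (+-suc K′ 1))
  own (p-mid a 1≤a a<K′) =
    InArc-≡ (c-path (suc (toℕ a)) refl (s≤s z≤n) (≤-trans a<K′ (n≤1+n K′)))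
            (InArc-intro 1 (s≤s 1≤n) (+-comm 1 (toℕ a)))
  own (p-pen a a≡K′) =
    InArc-≡ (c-path M (cong suc a≡K′) (s≤s z≤n) ≤-refl)
            (InArc-intro 1 (s≤s (≤-trans 1≤n (n≤1+n n))) (+-comm 1 K′))
  own (p-last a a≡M) = InArc-≡ (c-last a≡M) (InArc-intro n ≤-refl refl)
  own (q-first x) = InArc-wrap (suc (toℕ x)) (s≤s (Fin.toℕ<n x)) (sym (+-suc K′ (toℕ x)))
  own (q-mid e x _ _) = InArc-intro (toℕ x) (Fin.toℕ<n x) refl
  own (q-last e x e≡M) =
    InArc-≡ (col-M+ (toℕ x) e≡M) (InArc-intro (toℕ x) (≤-trans (Fin.toℕ<n x) (n≤1+n n)) refl)

  col-M : col M ≡ col 0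
  col-M = trans (col-+0 M) (col-+K 0)

  wrapped : ∀ {ℓ y} → suc y < ℓ → InArc K′ ℓ (col y)
  wrapped {y = y} 1+y<ℓ = InArc-wrap (suc y) 1+y<ℓ (sym (+-suc K′ y))

  path-nbrs : ∀ {a ℓ} (w : Class (p a) ℓ) u → Adj G (p a) u → InArc (start w) ℓ (c u)
  path-nbrs p-first (p b) (inj₁ 1≡b) = InArc-≡ (c-path 1 (sym 1≡b) (s≤s z≤n) (s≤s z≤n)) (wrapped (s≤s 2≤n))
  path-nbrs p-first (q fzero y) (inj₁ refl) = wrapped (s≤s (Fin.toℕ<n y))
  path-nbrs p-second (p b) (inj₁ 2≡b) =
    InArc-≡ (c-path 2 (sym 2≡b) (s≤s z≤n) (s≤s 1≤K′)) (wrapped (s≤s (s≤s 2≤n)))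
  path-nbrs p-second (p fzero) (inj₂ refl) = InArc-start (s≤s z≤n)
  path-nbrs p-second (q (fsuc fzero) y) (inj₁ refl) = wrapped (s≤s (s≤s (Fin.toℕ<n y)))
  path-nbrs p-second (q fzero y) (inj₂ refl) = wrapped (s≤s (≤-trans (Fin.toℕ<n y) (n≤1+n n)))
  path-nbrs (p-mid a 1≤a a<K′) (p b) (inj₁ 2+a≡b) =
    InArc-≡ (c-path (suc (suc (toℕ a))) (sym 2+a≡b) (s≤s z≤n) (s≤s a<K′))
            (InArc-intro 2 (s≤s 2≤n) (+-comm 2 (toℕ a)))
  path-nbrs (p-mid a 1≤a a<K′) (p b) (inj₂ 1+b≡1+a) =
    InArc-≡ (c-path (toℕ a) (suc-injective 1+b≡1+a) 1≤a (≤-trans (<⇒≤ a<K′) (n≤1+n K′)))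
            (InArc-start (s≤s z≤n))
  path-nbrs (p-mid a 1≤a a<K′) (q e y) (inj₁ 1+a≡e) = InArc-intro (suc (toℕ y)) (s≤s (Fin.toℕ<n y))
    (trans (cong (_+ toℕ y) (trans (sym (Fin.toℕ-inject₁ e)) (cong toℕ (sym 1+a≡e))))
           (sym (+-suc (toℕ a) (toℕ y))))
  path-nbrs (p-mid a 1≤a a<K′) (q _ y) (inj₂ refl) = InArc-intro (toℕ y) (≤-trans (Fin.toℕ<n y) (n≤1+n n)) refl
  path-nbrs (p-pen a a≡K′) (p (fsuc b)) (inj₁ 2+a≡2+b) =
    InArc-≡ (c-last (trans (sym (suc-injective 2+a≡2+b)) (cong suc a≡K′))) (wrapped ≤-refl)
  path-nbrs (p-pen a a≡K′) (p b) (inj₂ 1+b≡1+a) =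
    InArc-≡ (c-path K′ (trans (suc-injective 1+b≡1+a) a≡K′) 1≤K′ (n≤1+n K′)) (InArc-start (s≤s z≤n))
  path-nbrs (p-pen a a≡K′) (q e y) (inj₁ 1+a≡e) =
    InArc-≡ (col-M+ (toℕ y) (trans (trans (sym (Fin.toℕ-inject₁ e)) (cong toℕ (sym 1+a≡e))) (cong suc a≡K′)))
            (wrapped (s≤s (≤-trans (Fin.toℕ<n y) (n≤1+n n))))
  path-nbrs (p-pen a a≡K′) (q _ y) (inj₂ refl) =
    InArc-intro (toℕ y) (≤-trans (Fin.toℕ<n y) (≤-trans (n≤1+n n) (n≤1+n _))) (cong (_+ toℕ y) a≡K′)
  path-nbrs (p-last a a≡M) (p b) (inj₁ 2+a≡b) =
    ⊥-elim (<-irrefl refl (≤-trans (≤-reflexive 2+a≡b)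
                                    (subst (toℕ b ≤_) (cong suc (sym a≡M)) (Fin.toℕ≤pred[n] b))))
  path-nbrs (p-last a a≡M) (p b) (inj₂ 1+b≡1+a) =
    InArc-≡ (trans (c-path M (trans (suc-injective 1+b≡1+a) a≡M) (s≤s z≤n) ≤-refl) col-M) (InArc-start (s≤s z≤n))
  path-nbrs (p-last a a≡M) (q e y) (inj₁ 1+a≡e) =
    ⊥-elim (<-irrefl refl (≤-trans (≤-reflexive (trans (cong toℕ 1+a≡e) (Fin.toℕ-inject₁ e)))
                                    (subst (toℕ e ≤_) (sym a≡M) (Fin.toℕ≤pred[n] e))))
  path-nbrs (p-last a a≡M) (q _ y) (inj₂ refl) =
    InArc-≡ (col-M+ (toℕ y) a≡M) (InArc-intro (toℕ y) (≤-trans (Fin.toℕ<n y) (n≤1+n n)) refl)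

  copy-nbrs : ∀ {e x ℓ} (w : Class (q e x) ℓ) u → Adj G (q e x) u → InArc (start w) ℓ (c u)
  copy-nbrs (q-first x) (p fzero) (inj₁ refl) = InArc-start (s≤s z≤n)
  copy-nbrs (q-first x) (p (fsuc fzero)) (inj₂ refl) =
    InArc-≡ (c-path 1 refl (s≤s z≤n) (s≤s z≤n)) (wrapped (s≤s 2≤n))
  copy-nbrs (q-first x) (q fzero y) (refl , _) = wrapped (s≤s (Fin.toℕ<n y))
  copy-nbrs (q-mid e x 1≤e e<M) (p _) (inj₁ refl) =
    InArc-≡ (c-path (toℕ e) (Fin.toℕ-inject₁ e) 1≤e (<⇒≤ e<M)) (InArc-start (≤-trans (s≤s z≤n) 2≤n))
  copy-nbrs (q-mid e x 1≤e e<M) (p _) (inj₂ refl) =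
    InArc-≡ (c-path (suc (toℕ e)) refl (s≤s z≤n) e<M) (InArc-intro 1 2≤n (+-comm 1 (toℕ e)))
  copy-nbrs (q-mid e x _ _) (q _ y) (refl , _) = InArc-intro (toℕ y) (Fin.toℕ<n y) refl
  copy-nbrs (q-last e x e≡M) (p _) (inj₁ refl) =
    InArc-≡ (trans (c-path M (trans (Fin.toℕ-inject₁ e) e≡M) (s≤s z≤n) ≤-refl) col-M) (InArc-start (s≤s z≤n))
  copy-nbrs (q-last e x e≡M) (p _) (inj₂ refl) = InArc-≡ (c-last e≡M) (InArc-intro n ≤-refl refl)
  copy-nbrs (q-last e x e≡M) (q _ y) (refl , _) =
    InArc-≡ (col-M+ (toℕ y) e≡M) (InArc-intro (toℕ y) (≤-trans (Fin.toℕ<n y) (n≤1+n n)) refl)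

  nbrs : ∀ {v ℓ} (w : Class v ℓ) u → Adj G v u → InArc (start w) ℓ (c u)
  nbrs {p _} = path-nbrs
  nbrs {q _ _} = copy-nbrs

  x<K : ∀ (x : Fin n) → toℕ x < K
  x<K x = <-trans (Fin.toℕ<n x) (<-trans n<K′ ≤-refl)

  start<K : ∀ {v ℓ} (w : Class v ℓ) → start w < K
  start<K p-first = ≤-refl
  start<K p-second = ≤-refl
  start<K (p-mid _ _ a<K′) = <-trans a<K′ ≤-refl
  start<K (p-pen _ _) = ≤-refl
  start<K (p-last _ _) = s≤s z≤n
  start<K (q-first _) = ≤-refl
  start<K (q-mid _ _ _ e<M) = e<M
  start<K (q-last _ _ _) = s≤s z≤n

  K′≢0 : K′ ≢ 0
  K′≢0 K′≡0 = <-irrefl (sym K′≡0) 1≤K′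

  first-colours : ∀ x → c (p fzero) ≢ c (q fzero x)
  first-colours x colours = <-irrefl (sym (col-injective-< ≤-refl (x<K x) colours)) (<-trans (Fin.toℕ<n x) n<K′)

  last-colours : ∀ {a e x} → toℕ a ≡ M → toℕ e ≡ M → c (p (fsuc a)) ≢ c (q e x)
  last-colours {x = x} a≡M e≡M colours = <-irrefl (sym (col-injective-< (<-trans n<K′ ≤-refl) (x<K x)
    (trans (sym (c-last a≡M)) (trans colours (col-M+ (toℕ x) e≡M))))) (Fin.toℕ<n x)

  -- Within the arc length n + 1 the start K′ is shared by p₀ and the copy on the first edge,
  -- the start 0 by p_{M+1} and the copy on the last edge; these are told apart by colour.
  equal-starts : ∀ {u v} (wu : Class u (suc n)) (wv : Class v (suc n)) → c u ≡ c v → start wu ≡ start wv → u ≡ v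
  equal-starts p-first p-first _ _ = refl
  equal-starts p-first (p-mid _ _ a<K′) _ eq = ⊥-elim (<-irrefl (sym eq) a<K′)
  equal-starts p-first (p-last _ _) _ eq = ⊥-elim (K′≢0 eq)
  equal-starts p-first (q-first x) colours _ = ⊥-elim (first-colours x colours)
  equal-starts p-first (q-last _ _ _) _ eq = ⊥-elim (K′≢0 eq)
  equal-starts (p-mid _ _ a<K′) p-first _ eq = ⊥-elim (<-irrefl eq a<K′)
  equal-starts (p-mid a _ _) (p-mid b _ _) _ eq = cong (λ t → p (fsuc t)) (Fin.toℕ-injective eq)
  equal-starts (p-mid _ 1≤a _) (p-last _ _) _ eq = ⊥-elim (<-irrefl (sym eq) 1≤a)
  equal-starts (p-mid _ _ a<K′) (q-first _) _ eq = ⊥-elim (<-irrefl eq a<K′)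
  equal-starts (p-mid _ 1≤a _) (q-last _ _ _) _ eq = ⊥-elim (<-irrefl (sym eq) 1≤a)
  equal-starts (p-last _ _) p-first _ eq = ⊥-elim (K′≢0 (sym eq))
  equal-starts (p-last _ _) (p-mid _ 1≤b _) _ eq = ⊥-elim (<-irrefl eq 1≤b)
  equal-starts (p-last a a≡M) (p-last b b≡M) _ _ =
    cong (λ t → p (fsuc t)) (Fin.toℕ-injective (trans a≡M (sym b≡M)))
  equal-starts (p-last _ _) (q-first _) _ eq = ⊥-elim (K′≢0 (sym eq))
  equal-starts (p-last a a≡M) (q-last e x e≡M) colours _ = ⊥-elim (last-colours a≡M e≡M colours)
  equal-starts (q-first x) p-first colours _ = ⊥-elim (first-colours x (sym colours))
  equal-starts (q-first _) (p-mid _ _ b<K′) _ eq = ⊥-elim (<-irrefl (sym eq) b<K′)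
  equal-starts (q-first _) (p-last _ _) _ eq = ⊥-elim (K′≢0 eq)
  equal-starts (q-first x) (q-first y) colours _ =
    cong (λ t → q fzero t) (Fin.toℕ-injective (col-injective-< (x<K x) (x<K y) colours))
  equal-starts (q-first _) (q-last _ _ _) _ eq = ⊥-elim (K′≢0 eq)
  equal-starts (q-last _ _ _) p-first _ eq = ⊥-elim (K′≢0 (sym eq))
  equal-starts (q-last _ _ _) (p-mid _ 1≤b _) _ eq = ⊥-elim (<-irrefl eq 1≤b)
  equal-starts (q-last e x e≡M) (p-last a a≡M) colours _ = ⊥-elim (last-colours a≡M e≡M (sym colours))
  equal-starts (q-last _ _ _) (q-first _) _ eq = ⊥-elim (K′≢0 (sym eq))
  equal-starts (q-last e x e≡M) (q-last e′ y e′≡M) colours _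
    with Fin.toℕ-injective {i = e} {j = e′} (trans e≡M (sym e′≡M))
  ... | refl = cong (λ t → q e t) (Fin.toℕ-injective (col-injective-< (x<K x) (x<K y)
    (trans (sym (col-M+ (toℕ x) e≡M)) (trans colours (col-M+ (toℕ y) e≡M)))))

  partial : ∀ {ℓ} {X : Set} → ℓ < K → ℓ ≡ K ⊎ X → X
  partial ℓ<K (inj₁ ℓ≡K) = ⊥-elim (<-irrefl ℓ≡K ℓ<K)
  partial _ (inj₂ x) = x

  via-starts : ∀ {u v} (wu : Class u (suc n)) (wv : Class v (suc n)) → c u ≡ c v →
               suc n ≡ K ⊎ start wu % K ≡ start wv % K → u ≡ v
  via-starts wu wv colours same =
    equal-starts wu wv colours (%-injective (start<K wu) (start<K wv) (partial (s≤s n<K′) same))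

  second≢pen : ∀ a → toℕ a ≡ K′ → c (p (fsuc fzero)) ≢ c (p (fsuc a))
  second≢pen a a≡K′ colours = 0≢1+n (sym (col-injective-< (s≤s 1≤K′) (s≤s z≤n)
    (trans (sym (c-path 1 refl (s≤s z≤n) (s≤s z≤n)))
           (trans colours (trans (c-path M (cong suc a≡K′) (s≤s z≤n) ≤-refl) col-M)))))

  same-arc : ∀ {u v ℓ} (wu : Class u ℓ) (wv : Class v ℓ) → c u ≡ c v →
             ℓ ≡ K ⊎ start wu % K ≡ start wv % K → u ≡ v
  same-arc p-second p-second _ _ = refl
  same-arc p-second (p-pen a a≡K′) colours _ = ⊥-elim (second≢pen a a≡K′ colours)
  same-arc (p-pen a a≡K′) p-second colours _ = ⊥-elim (second≢pen a a≡K′ (sym colours))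
  same-arc (p-pen a a≡K′) (p-pen b b≡K′) _ _ =
    cong (λ t → p (fsuc t)) (Fin.toℕ-injective (trans a≡K′ (sym b≡K′)))
  same-arc (q-mid e x _ e<M) (q-mid e′ y _ e′<M) colours same
    with Fin.toℕ-injective {i = e} {j = e′} (%-injective e<M e′<M (partial (<-trans n<K′ ≤-refl) same))
  ... | refl = cong (λ t → q e t) (Fin.toℕ-injective (col-cancelˡ (toℕ e) (x<K x) (x<K y) colours))
  same-arc wu@p-first wv = via-starts wu wv
  same-arc wu@(p-mid _ _ _) wv = via-starts wu wv
  same-arc wu@(p-last _ _) wv = via-starts wu wv
  same-arc wu@(q-first _) wv = via-starts wu wv
  same-arc wu@(q-last _ _ _) wv = via-starts wu wv

  c-path-at : ∀ t → 1 ≤ t → t ≤ M → ∃ λ v → c v ≡ col t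
  c-path-at t 1≤t t≤M = p (fromℕ< t<M+2) , c-path t (Fin.toℕ-fromℕ< t<M+2) 1≤t t≤M
    where
    t<M+2 : t < suc (suc M)
    t<M+2 = s≤s (≤-trans t≤M (n≤1+n M))

  onto : ∀ i → ∃ λ v → c v ≡ i
  onto fzero with c-path-at M (s≤s z≤n) ≤-refl
  ... | v , cv≡ = v , trans cv≡ col-M
  onto i@(fsuc j) with c-path-at (toℕ i) (s≤s z≤n) (<⇒≤ (Fin.toℕ<n i))
  ... | v , cv≡ = v , trans cv≡ (col-toℕ i)

  length-bounds : ∀ {v ℓ} → Class v ℓ → 1 ≤ ℓ × ℓ ≤ K
  length-bounds p-first = s≤s z≤n , <⇒≤ (s≤s n<K′)
  length-bounds p-second = s≤s z≤n , n+2≤M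
  length-bounds (p-mid _ _ _) = s≤s z≤n , <⇒≤ (s≤s n<K′)
  length-bounds (p-pen _ _) = s≤s z≤n , n+2≤M
  length-bounds (p-last _ _) = s≤s z≤n , <⇒≤ (s≤s n<K′)
  length-bounds (q-first _) = s≤s z≤n , <⇒≤ (s≤s n<K′)
  length-bounds (q-mid _ _ _ _) = 1≤n , <⇒≤ (<-trans n<K′ ≤-refl)
  length-bounds (q-last _ _ _) = s≤s z≤n , <⇒≤ (s≤s n<K′)

  rainbow : RainbowColoring G K c
  rainbow = Corona.rainbow M n c interior-injective
    where
    interior-injective : ∀ {a b} → Interior M a → Interior M b → c (p a) ≡ c (p b) → a ≡ b
    interior-injective {a} {b} (1≤a , a≤M) (1≤b , b≤M) colours =
      Fin.toℕ-injective (col-injective-≤ 1≤a a≤M 1≤b b≤M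
        (trans (sym (c-path (toℕ a) refl 1≤a a≤M)) (trans colours (c-path (toℕ b) refl 1≤b b≤M))))

  locating : LocatingRainbowColoring G K c
  locating = locating-intro c decidable rainbow onto
    (ArcColouring.separated c Class class start length-bounds covers own nbrs same-arc)

-- The rainbow vertex numbers

IsRvc-intro : ∀ {G k} → 1 ≤ k → HasRainbowColoring G k →
              (∀ j → 1 ≤ j → HasRainbowColoring G j → k ≤ j) → IsRvc G k
IsRvc-intro 1≤k has bound = 1≤k , has , λ j 1≤j j<k h → <⇒≱ j<k (bound j 1≤j h)

IsRvcl-intro : ∀ {G k} → 1 ≤ k → HasLocatingRainbowColoring G k →
               (∀ j → HasLocatingRainbowColoring G j → k ≤ j) → IsRvcl G k
IsRvcl-intro 1≤k has bound = 1≤k , has , λ j _ j<k h → <⇒≱ j<k (bound j h)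

suc[m∸1]-lub : ∀ {M j} → M ≤ j → 1 ≤ j → suc (M ∸ 1) ≤ j
suc[m∸1]-lub {zero} _ 1≤j = 1≤j
suc[m∸1]-lub {suc M} M≤j _ = M≤j

rvc-path : ∀ M → IsRvc (PathGraph (2 + M)) (suc (M ∸ 1))
rvc-path M = IsRvc-intro (s≤s z≤n) (c , rainbow c interior-injective)
  λ j 1≤j (c′ , rb) → suc[m∸1]-lub (rainbow-bound c′ rb) 1≤j
  where
  open Path M
  open Arcs (M ∸ 1)

  c : Fin (2 + M) → Fin K
  c a = col (toℕ a ∸ 1)

  interior-injective : ∀ {a b} → Interior M a → Interior M b → c a ≡ c b → a ≡ b
  interior-injective {a} {b} (1≤a , a≤M) (1≤b , b≤M) colours = Fin.toℕ-injective (begin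
    toℕ a            ≡⟨ m+[n∸m]≡n 1≤a ⟨
    1 + (toℕ a ∸ 1)  ≡⟨ cong suc (col-injective-< (s≤s (∸-monoˡ-≤ 1 a≤M)) (s≤s (∸-monoˡ-≤ 1 b≤M)) colours) ⟩
    1 + (toℕ b ∸ 1)  ≡⟨ m+[n∸m]≡n 1≤b ⟩
    toℕ b            ∎)

module SingleEdge (n : ℕ) where
  open Corona 0 n hiding (rainbow)

  c : V G → Fin (2 + n)
  c v = join 2 n (map₂ proj₂ v)

  c-injective : ∀ {u v} → c u ≡ c v → u ≡ v
  c-injective {u} {v} eq =
    forget-injective (trans (sym (Fin.splitAt-join 2 n _)) (trans (cong (splitAt 2) eq) (Fin.splitAt-join 2 n _)))
    where
    forget-injective : ∀ {u v} → map₂ proj₂ u ≡ map₂ proj₂ v → u ≡ v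
    forget-injective {p _} {p _} refl = refl
    forget-injective {q fzero _} {q fzero _} refl = refl

  onto : ∀ i → ∃ λ v → c v ≡ i
  onto i = map₂ (fzero ,_) (splitAt 2 i) ,
           trans (cong (join 2 n) (forget-section (splitAt 2 i))) (Fin.join-splitAt 2 n i)
    where
    forget-section : ∀ s → map₂ proj₂ (map₂ (fzero ,_) s) ≡ s
    forget-section (inj₁ _) = refl
    forget-section (inj₂ _) = refl

  locating : LocatingRainbowColoring G (2 + n) c
  locating = locating-intro c decidable (Corona.rainbow 0 n c (λ (1≤a , a≤0) → ⊥-elim (<⇒≱ 1≤a a≤0)))
    onto λ u v u≢v cu≡cv → ⊥-elim (u≢v (c-injective cu≡cv))

short-path-max : ∀ {M n} → M ≤ suc n → suc (M ∸ 1) ⊔ (n + 2) ≡ 2 + n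
short-path-max {M} {n} M≤n+1 = trans (m≤n⇒m⊔n≡n (≤-trans (suc[m∸1]-lub M≤n+1 (s≤s z≤n)) n+1≤n+2)) (+-comm n 2)
  where
  n+1≤n+2 : suc n ≤ n + 2
  n+1≤n+2 = subst (suc n ≤_) (+-comm 2 n) (n≤1+n (suc n))

locating-colouring-exists : ∀ M n → 2 ≤ n →
  HasLocatingRainbowColoring (PathCoronaComplete (2 + M) n) (suc (M ∸ 1) ⊔ (n + 2))
locating-colouring-exists zero n _ =
  subst (HasLocatingRainbowColoring _) (sym (short-path-max z≤n)) (_ , SingleEdge.locating n)
locating-colouring-exists (suc M) n 2≤n with suc M ≤? suc n
... | yes M+1≤n+1 = subst (HasLocatingRainbowColoring _) (sym (short-path-max M+1≤n+1))
    (_ , ShortPath.locating (suc M) n (s≤s z≤n) M+1≤n+1 (≤-trans (s≤s z≤n) 2≤n))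
... | no M+1≰n+1 = subst (HasLocatingRainbowColoring _) (sym (m≥n⇒m⊔n≡m n+2≤M+1))
    (_ , LongPath.locating M n 2≤n (≰⇒> M+1≰n+1))
  where
  n+2≤M+1 : n + 2 ≤ suc M
  n+2≤M+1 = subst (_≤ suc M) (+-comm 2 n) (≰⇒> M+1≰n+1)

rvcl-corona : ∀ M n → 2 ≤ n → IsRvcl (PathCoronaComplete (2 + M) n) (suc (M ∸ 1) ⊔ (n + 2))
rvcl-corona M n 2≤n =
  IsRvcl-intro (≤-trans (s≤s z≤n) (m≤m⊔n (suc (M ∸ 1)) (n + 2))) (locating-colouring-exists M n 2≤n) lower
  where
  open Corona M n
  lower : ∀ j → HasLocatingRainbowColoring G j → suc (M ∸ 1) ⊔ (n + 2) ≤ j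
  lower j (c , loc) = ⊔-lub (suc[m∸1]-lub (rainbow-bound c (proj₁ loc)) (≤-trans (s≤s z≤n) n+2≤j))
                            (subst (_≤ j) (+-comm 2 n) n+2≤j)
    where
    n+2≤j : 2 + n ≤ j
    n+2≤j = twin-bound c loc

mainTheorem7 : (m n : ℕ) → 2 ≤ m → 2 ≤ n →
    Σ ℕ (λ r → IsRvc (PathGraph m) r × IsRvcl (PathCoronaComplete m n) (r ⊔ (n + 2)))
mainTheorem7 (suc (suc M)) n (s≤s (s≤s z≤n)) 2≤n = suc (M ∸ 1) , rvc-path M , rvcl-corona M n 2≤n
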